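{- Let $u,v \in S_{\mathbb{Z}_+}$ with $\ell(u) + \ell(v) = k$. \begin{enumerate} \item[(a)] $\max_{i \geq 0}(I_i(u,v) - i) = \max_{i \geq 0}(\lambda_i(u) + \lambda_i(v) - i)$. \item[(b)] Let $i \geq 0$ be such that $I_i(u,v) - i$ attains its maximum. Let $\boldsymbol{p} \in \mathbf{Sch}(u)\mathbf{Sch}(v)$ with $I_i(\boldsymbol{p}) = I_i(u,v)$. Then either $\mathrm{IncSuf}_i(m(\boldsymbol{p})) = \emptyset$ or $\mathrm{IncSuf}_i(m(\boldsymbol{p})) = (i-I(\boldsymbol{p})+1, i-I(\boldsymbol{p})+2, \ldots, i)$. \end{enumerate}
   Context: $S_{\mathbb{Z}_+}$ is the set of finitely-supported permutations of the positive integers; $\ell$ is Coxeter length. For $w$, $\theta_j(w)=1$ if there is $j'>j$ with $w(j)>w(j')$ (i.e. the $j$th Lehmer code entry is nonzero), else $0$, and $\lambda_i(w)=\sum_{j\le i}\theta_j(w)$. Colored words are words over $\overline{\mathbb{Z}}=\{i^{[j]}\}$ (value $i$, color $j$), ordered by value then color. $\mathbf{Sch}(w)=\sum_{\boldsymbol{w}\in\mathcal{RW}(w)}\boldsymbol{w}$ (sum of reduced words), and $\mathbf{Sch}(u)\mathbf{Sch}(v)$ is the colored shuffle product $\sum \boldsymbol{u}\sqcup\!\sqcup(\boldsymbol{v}\uparrow\operatorname{maxcol}(\boldsymbol{u}))$ over reduced words $\boldsymbol{u}$ of $u$, $\boldsymbol{v}$ of $v$, where $\sqcup\!\sqcup$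 is the Eilenberg–Mac Lane shuffle product (sum of order-preserving interlacings) and colors of $\boldsymbol{v}$ are shifted above those of $\boldsymbol{u}$; regarded as a multiset. For a word $\boldsymbol{p}$: $\mathrm{IncSuf}(\boldsymbol{p})$ is its longest strictly increasing suffix, of length $I(\boldsymbol{p})$; $\mathrm{IncSuf}_i(\boldsymbol{p})=\mathrm{IncSuf}(\boldsymbol{p})$ if the last entry has value $\le i$, else $\emptyset$, with length $I_i(\boldsymbol{p})$. $I_i(u,v)=\max_{\boldsymbol{p}\in\mathbf{Sch}(u)\mathbf{Sch}(v)}I_i(\boldsymbol{p})$. The maximal bottom row $m(\boldsymbol{t})$ of $\boldsymbol{t}=(t_1,\dots,t_k)$ is $m(\boldsymbol{t})_k=\mathrm{val}(t_k)$ and for $j<k$, $m(\boldsymbol{t})_j=m(\boldsymbol{t})_{j+1}$ if $t_j\ge t_{j+1}$, else $\min(\mathrm{val}(t_j),m(\boldsymbol{t})_{j+1}-1)$. -}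

module Defs where

open import Data.Nat as ℕ using (ℕ; zero; suc; _<_; _≤_; _≡ᵇ_; _<ᵇ_; _≤ᵇ_)
open import Data.Integer as ℤ using (ℤ; +_)
open import Data.Bool using (Bool; true; false; if_then_else_; _∧_; _∨_)
open import Data.List using (List; []; _∷_; [_]; length; reverse; map; last; upTo)
open import Data.List.Relation.Unary.All using (All)
open import Data.Maybe using (Maybe; just; nothing)
open import Data.Product using (Σ; ∃; ∃-syntax; _×_; _,_; proj₁)
open import Relation.Nullary using (¬_; does)
open import Relation.Binary.PropositionalEquality using (_≡_)

-- Finitely supported permutations of the positive integers.
-- A permutation is a bijection of ℕ fixing 0 (0 is just padding: only the
-- values on positive integers matter) with finite support.

record FinPerm : Set where
  field
    fn      : ℕ → ℕ
    fix0    : fn 0 ≡ 0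
    inj     : ∀ a b → fn a ≡ fn b → a ≡ b
    surj    : ∀ b → ∃[ a ] (fn a ≡ b)
    support : ∃[ N ] (∀ j → N < j → fn j ≡ j)
open FinPerm public

s : ℕ → ℕ → ℕ
s i j = if j ≡ᵇ i then suc i else (if j ≡ᵇ suc i then i else j)

prod : List ℕ → ℕ → ℕ
prod []       j = j
prod (a ∷ as) j = s a (prod as j)

Letters : List ℕ → Set
Letters = All (λ x → 1 ≤ x)

IsWordFor : FinPerm → List ℕ → Set
IsWordFor w a = Letters a × (∀ j → prod a j ≡ fn w j)

IsReducedWord : FinPerm → List ℕ → Set
IsReducedWord w a = IsWordFor w a × (∀ b → IsWordFor w b → length a ≤ length b)

Theta : FinPerm → ℕ → Set
Theta w j = ∃[ j' ] (j < j' × fn w j' < fn w j)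

data Lambda (w : FinPerm) : ℕ → ℕ → Set where
  lam0   : Lambda w 0 0
  lamYes : ∀ {i c} → Lambda w i c → Theta w (suc i) → Lambda w (suc i) (suc c)
  lamNo  : ∀ {i c} → Lambda w i c → ¬ Theta w (suc i) → Lambda w (suc i) c

CLetter : Set
CLetter = ℕ × ℕ

val : CLetter → ℕ
val = proj₁

_<ᶜ_ : CLetter → CLetter → Bool
(a , c) <ᶜ (b , d) = (a <ᵇ b) ∨ ((a ≡ᵇ b) ∧ (c <ᵇ d))

_<ℤ_ : ℤ → ℤ → Bool
x <ℤ y = does (x ℤ.<? y)

decPre : {A : Set} → (A → A → Bool) → List A → List A
decPre lt []           = []
decPre lt (x ∷ [])     = x ∷ []
decPre lt (x ∷ y ∷ ys) = if lt y x then x ∷ decPre lt (y ∷ ys) else x ∷ []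

incSuf : {A : Set} → (A → A → Bool) → List A → List A
incSuf lt xs = reverse (decPre lt (reverse xs))

incSufI : ℕ → List CLetter → List CLetter
incSufI i p with last p
... | nothing = []
... | just t  = if val t ≤ᵇ i then incSuf _<ᶜ_ p else []

incSufIℤ : ℕ → List ℤ → List ℤ
incSufIℤ i p with last p
... | nothing = []
... | just t  = if t ℤ.≤ᵇ (+ i) then incSuf _<ℤ_ p else []

I : List CLetter → ℕ
I p = length (incSuf _<ᶜ_ p)

Ii : ℕ → List CLetter → ℕ
Ii i p = length (incSufI i p)

-- Colored shuffle product Sch(u)Sch(v) (as a multiset; only membership used)

data Interleave {A : Set} : List A → List A → List A → Set where
  nil   : Interleave [] [] []
  left  : ∀ {x xs ys zs} → Interleave xs ys zs → Interleave (x ∷ xs) ys (x ∷ zs)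
  right : ∀ {y xs ys zs} → Interleave xs ys zs → Interleave xs (y ∷ ys) (y ∷ zs)

color : ℕ → List ℕ → List CLetter
color c = map (λ x → (x , c))

-- p ∈ Sch(u)Sch(v): uncolored letters carry color 1, v's colors shifted to 2
InSchProd : FinPerm → FinPerm → List CLetter → Set
InSchProd u v p = ∃[ a ] ∃[ b ] (IsReducedWord u a × IsReducedWord v b
                    × Interleave (color 1 a) (color 2 b) p)

MaxI : FinPerm → FinPerm → ℕ → ℕ → Set
MaxI u v i n = (∃[ p ] (InSchProd u v p × Ii i p ≡ n))
             × (∀ p → InSchProd u v p → Ii i p ≤ n)

mrowStep : CLetter → CLetter → ℤ → ℤ
mrowStep t t' m = if t <ᶜ t' then (+ val t) ℤ.⊓ (m ℤ.- ℤ.1ℤ) else m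

headℤ : List ℤ → ℤ
headℤ []      = + 0
headℤ (x ∷ _) = x

mrow : List CLetter → List ℤ
mrow []            = []
mrow (t ∷ [])      = [ + val t ]
mrow (t ∷ t' ∷ ts) = cons t t' (mrow (t' ∷ ts))
  where
  cons : CLetter → CLetter → List ℤ → List ℤ
  cons t t' r = mrowStep t t' (headℤ r) ∷ r

IsMaxOver : (ℕ → ℤ → Set) → ℤ → Set
IsMaxOver R m = (∃[ i ] R i m) × (∀ i x → R i x → x ℤ.≤ m)

range : ℕ → ℕ → List ℤ
range i len = map (λ t → (+ i ℤ.- + len) ℤ.+ + suc t) (upTo len)

{-# OPTIONS --safe #-}
module Submission where

-- Coxeter length equals the number of inversions, so a word ending in the letter x is reduced
-- for w exactly when w(x+1) < w(x) and the rest is reduced for w s_x. Peeling letters off the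
-- end, the letters ≤ y of an increasing suffix of a reduced word of w number at most λ_y(w),
-- and when θ_{i+1}(w) = 0 some reduced word ends in λ_i(w) increasing letters ≤ i.
--
-- The increasing suffix of a shuffle p of reduced words of u and v splits into increasing
-- suffixes of the two factors, so I_i(p) ≤ λ_i(u) + λ_i(v). At the last maximizer i of
-- λ_i(u) + λ_i(v) − i neither θ_{i+1} is 1, and merging the two extremal suffixes attains the
-- bound; this gives (a). For (b), apply the counting bound at y = val t for each letter t of
-- the increasing suffix of p: with the maximality of I_i − i it shows that t is at least i minus
-- the number of letters after t. This pins the maximal bottom row of the suffix down to
-- (i − I + 1, …, i), and the letter preceding the suffix repeats the first of these values,
-- so the increasing suffix of the bottom row is exactly that range.

open import Defs
open import Data.Bool using (Bool; true; false; T; if_then_else_)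
open import Data.Maybe using (just)
open import Data.Bool.Properties using (T-∧; T-∨)
open import Data.Empty using (⊥-elim)
open import Data.Unit using (⊤; tt)
open import Data.Nat as ℕ
  using (ℕ; zero; suc; _+_; _∸_; _≤_; _<_; _≤ᵇ_; _<ᵇ_; z≤n; s≤s; _⊔_; _≤?_; _<?_)
open import Data.Nat.Properties
open import Data.List using (List; []; _∷_; _++_; [_]; _∷ʳ_; length; reverse; map; filter; last; applyUpTo)
open import Data.List.Properties
  using ( length-++; length-reverse; length-map; reverse-++; reverse-involutive; unfold-reverse; ++-assoc
        ; ++-identityʳ; ∷-injectiveˡ; ∷-injectiveʳ; map-++; map-applyUpTo; map-∘; map-id
        ; length-filter; filter-all; filter-accept; filter-reject; filter-++)
open import Data.List.Relation.Unary.All as All using (All; []; _∷_)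
import Data.List.Relation.Unary.All.Properties as All
open import Data.List.Relation.Unary.AllPairs as AllPairs using (AllPairs; []; _∷_)
open import Data.List.Relation.Unary.Linked as Linked using (Linked; []; [-]; _∷_)
open import Data.List.Relation.Unary.Linked.Properties using (Linked⇒AllPairs; AllPairs⇒Linked)
import Data.List.Relation.Unary.AllPairs.Properties as AllPairs
open import Data.List.Reverse using (Reverse; []; _∶_∶ʳ_; reverseView)
open import Data.Product using (Σ-syntax; ∃; ∃-syntax; _×_; _,_; proj₁; proj₂)
open import Data.Sum using (_⊎_; inj₁; inj₂)
open import Function using (id; _∘_; flip; Equivalence)
open import Relation.Nullary using (¬_; Dec; yes; no; contradiction)
open import Relation.Nullary.Decidable using (map′; _×-dec_; T?)
open import Relation.Binary using (tri<; tri≈; tri>)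
open import Relation.Binary.PropositionalEquality
  using (_≡_; _≢_; refl; sym; trans; cong; cong₂; subst; subst₂; module ≡-Reasoning)
open import Data.Nat.Tactic.RingSolver using (solve-∀)
open import Data.Integer as ℤ using (ℤ; +_; _-_; 1ℤ; +≤+)
import Data.Integer.Properties as ℤ
import Data.Integer.Tactic.RingSolver as ℤ-Solver
open import Algebra.Properties.CommutativeSemigroup +-commutativeSemigroup using (xy∙z≈xz∙y)

open Equivalence using (to; from)

if-T : ∀ {A : Set} {b} {x y : A} → T b → (if b then x else y) ≡ x
if-T {b = true} _ = refl

if-¬T : ∀ {A : Set} {b} {x y : A} → ¬ T b → (if b then x else y) ≡ y
if-¬T {b = true}  ¬b = ⊥-elim (¬b tt)
if-¬T {b = false} _  = refl

if-elim : ∀ {A : Set} (P : A → Set) b {x y : A} → (T b → P x) → (¬ T b → P y) → P (if b then x else y)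
if-elim P true  px _  = px tt
if-elim P false _  py = py λ ()

indicator : Bool → ℕ
indicator true  = 1
indicator false = 0

indicator-¬T : ∀ {b} → ¬ T b → indicator b ≡ 0
indicator-¬T {true}  ¬b = ⊥-elim (¬b tt)
indicator-¬T {false} _  = refl

indicator-T : ∀ {b} → T b → indicator b ≡ 1
indicator-T {true} _ = refl

indicator≤1 : ∀ b → indicator b ≤ 1
indicator≤1 true  = ≤-refl
indicator≤1 false = z≤n

countAtMost : ℕ → List ℕ → ℕ
countAtMost y xs = length (filter (_≤? y) xs)

countAtMost-accept : ∀ {y x xs} → x ≤ y → countAtMost y (x ∷ xs) ≡ suc (countAtMost y xs)
countAtMost-accept {y} x≤y = cong length (filter-accept (_≤? y) x≤y)

countAtMost-reject : ∀ {y x xs} → ¬ x ≤ y → countAtMost y (x ∷ xs) ≡ countAtMost y xs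
countAtMost-reject {y} x≰y = cong length (filter-reject (_≤? y) x≰y)

countAtMost-all : ∀ {y xs} → All (_≤ y) xs → countAtMost y xs ≡ length xs
countAtMost-all {y} xs≤y = cong length (filter-all (_≤? y) xs≤y)

countAtMost-++ : ∀ y xs ys → countAtMost y (xs ++ ys) ≡ countAtMost y xs + countAtMost y ys
countAtMost-++ y xs ys = trans (cong length (filter-++ (_≤? y) xs ys)) (length-++ (filter (_≤? y) xs))

AllPairs-++⁻ˡ : ∀ {A : Set} {R : A → A → Set} xs {ys} → AllPairs R (xs ++ ys) → AllPairs R xs
AllPairs-++⁻ˡ []       _         = []
AllPairs-++⁻ˡ (x ∷ xs) (x~ ∷ r) = All.++⁻ˡ xs x~ ∷ AllPairs-++⁻ˡ xs r

AllPairs-before : ∀ {A : Set} {R : A → A → Set} xs {y ys} → AllPairs R (xs ++ y ∷ ys) → All (λ x → R x y) xs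
AllPairs-before []       _ = []
AllPairs-before (x ∷ xs) (x~ ∷ r) with All.++⁻ʳ xs x~
... | Rxy ∷ _ = Rxy ∷ AllPairs-before xs r

Linked-∷ʳ : ∀ {A : Set} {R : A → A → Set} xs {x y} → Linked R (xs ∷ʳ x) → R x y → Linked R ((xs ∷ʳ x) ∷ʳ y)
Linked-∷ʳ []           _            Rxy = Rxy ∷ [-]
Linked-∷ʳ (a ∷ [])     (Rax ∷ _)    Rxy = Rax ∷ Rxy ∷ [-]
Linked-∷ʳ (a ∷ b ∷ xs) (Rab ∷ rest) Rxy = Rab ∷ Linked-∷ʳ (b ∷ xs) rest Rxy

Linked-reverse-∷ : ∀ {A : Set} {R : A → A → Set} {x} xs → Linked R (x ∷ xs) → Linked (flip R) (reverse xs ∷ʳ x)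
Linked-reverse-∷         []       _            = [-]
Linked-reverse-∷ {R = R} {x} (y ∷ ys) (Rxy ∷ rest) =
  subst (Linked (flip R)) (cong (_∷ʳ x) (sym (unfold-reverse y ys))) (Linked-∷ʳ (reverse ys) (Linked-reverse-∷ ys rest) Rxy)

Linked-reverse : ∀ {A : Set} {R : A → A → Set} xs → Linked R xs → Linked (flip R) (reverse xs)
Linked-reverse         []       _      = []
Linked-reverse {R = R} (x ∷ xs) linked = subst (Linked (flip R)) (sym (unfold-reverse x xs)) (Linked-reverse-∷ xs linked)

map-++⁻ : ∀ {A B : Set} (f : A → B) xs {ys zs} → map f xs ≡ ys ++ zs →
  ∃[ xs₁ ] ∃[ xs₂ ] (xs ≡ xs₁ ++ xs₂ × map f xs₁ ≡ ys × map f xs₂ ≡ zs)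
map-++⁻ f xs       {[]}     e = [] , xs , refl , refl , e
map-++⁻ f (x ∷ xs) {_ ∷ ys} e with map-++⁻ f xs {ys} (∷-injectiveʳ e)
... | xs₁ , xs₂ , refl , e₁ , e₂ = x ∷ xs₁ , xs₂ , refl , cong₂ _∷_ (∷-injectiveˡ e) e₁ , e₂

last-∷ʳ : ∀ {A : Set} (xs : List A) x → last (xs ∷ʳ x) ≡ just x
last-∷ʳ []           x = refl
last-∷ʳ (y ∷ [])     x = refl
last-∷ʳ (y ∷ z ∷ xs) x = last-∷ʳ (z ∷ xs) x

Interleave-suffix : ∀ {A : Set} P {S xs ys : List A} → Interleave xs ys (P ++ S) →
  ∃[ xs₁ ] ∃[ xs₂ ] ∃[ ys₁ ] ∃[ ys₂ ] (xs ≡ xs₁ ++ xs₂ × ys ≡ ys₁ ++ ys₂ × Interleave xs₂ ys₂ S)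
Interleave-suffix []      {xs = xs} {ys} il = [] , xs , [] , ys , refl , refl , il
Interleave-suffix (x ∷ P) (left il) with Interleave-suffix P il
... | xs₁ , xs₂ , ys₁ , ys₂ , refl , refl , il′ = x ∷ xs₁ , xs₂ , ys₁ , ys₂ , refl , refl , il′
Interleave-suffix (y ∷ P) (right il) with Interleave-suffix P il
... | xs₁ , xs₂ , ys₁ , ys₂ , refl , refl , il′ = xs₁ , xs₂ , y ∷ ys₁ , ys₂ , refl , refl , il′

Interleave-All⁻ : ∀ {A : Set} {P : A → Set} {xs ys zs} → Interleave xs ys zs → All P zs → All P xs × All P ys
Interleave-All⁻ nil        []       = [] , []
Interleave-All⁻ (left il)  (p ∷ ps) = let pxs , pys = Interleave-All⁻ il ps in p ∷ pxs , pys
Interleave-All⁻ (right il) (p ∷ ps) = let pxs , pys = Interleave-All⁻ il ps in pxs , p ∷ pys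

Interleave-All⁺ : ∀ {A : Set} {P : A → Set} {xs ys zs} → Interleave xs ys zs → All P xs → All P ys → All P zs
Interleave-All⁺ nil        []         []         = []
Interleave-All⁺ (left il)  (px ∷ pxs) pys        = px ∷ Interleave-All⁺ il pxs pys
Interleave-All⁺ (right il) pxs        (py ∷ pys) = py ∷ Interleave-All⁺ il pxs pys

Interleave-AllPairs : ∀ {A : Set} {R : A → A → Set} {xs ys zs} → Interleave xs ys zs →
  AllPairs R zs → AllPairs R xs × AllPairs R ys
Interleave-AllPairs nil        []         = [] , []
Interleave-AllPairs (left il)  (r ∷ rs) =
  let rxs , rys = Interleave-AllPairs il rs in proj₁ (Interleave-All⁻ il r) ∷ rxs , rys
Interleave-AllPairs (right il) (r ∷ rs) =
  let rxs , rys = Interleave-AllPairs il rs in rxs , proj₂ (Interleave-All⁻ il r) ∷ rys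

Interleave-map : ∀ {A B : Set} (f : A → B) {xs ys zs} → Interleave xs ys zs → Interleave (map f xs) (map f ys) (map f zs)
Interleave-map f nil        = nil
Interleave-map f (left il)  = left (Interleave-map f il)
Interleave-map f (right il) = right (Interleave-map f il)

Interleave-++ : ∀ {A : Set} {xs₁ ys₁ zs₁ xs₂ ys₂ zs₂ : List A} →
  Interleave xs₁ ys₁ zs₁ → Interleave xs₂ ys₂ zs₂ → Interleave (xs₁ ++ xs₂) (ys₁ ++ ys₂) (zs₁ ++ zs₂)
Interleave-++ nil        il₂ = il₂
Interleave-++ (left il)  il₂ = left (Interleave-++ il il₂)
Interleave-++ (right il) il₂ = right (Interleave-++ il il₂)

Interleave-concat : ∀ {A : Set} (xs ys : List A) → Interleave xs ys (xs ++ ys)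
Interleave-concat []       []       = nil
Interleave-concat []       (y ∷ ys) = right (Interleave-concat [] ys)
Interleave-concat (x ∷ xs) ys       = left (Interleave-concat xs ys)

Interleave-length : ∀ {A : Set} {xs ys zs : List A} → Interleave xs ys zs → length zs ≡ length xs + length ys
Interleave-length nil                   = refl
Interleave-length (left il)             = cong suc (Interleave-length il)
Interleave-length {xs = xs} (right {ys = ys} il) = trans (cong suc (Interleave-length il)) (sym (+-suc (length xs) (length ys)))

Interleave-countAtMost : ∀ y {xs ys zs} → Interleave xs ys zs → countAtMost y zs ≡ countAtMost y xs + countAtMost y ys
Interleave-countAtMost y nil = refl
Interleave-countAtMost y {x ∷ xs} {ys} {x ∷ zs} (left il) with x ≤? y
... | yes x≤y = begin
  countAtMost y (x ∷ zs)                       ≡⟨ countAtMost-accept x≤y ⟩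
  suc (countAtMost y zs)                       ≡⟨ cong suc (Interleave-countAtMost y il) ⟩
  suc (countAtMost y xs) + countAtMost y ys    ≡⟨ cong (_+ countAtMost y ys) (countAtMost-accept x≤y) ⟨
  countAtMost y (x ∷ xs) + countAtMost y ys    ∎
  where open ≡-Reasoning
... | no x≰y = begin
  countAtMost y (x ∷ zs)                       ≡⟨ countAtMost-reject x≰y ⟩
  countAtMost y zs                             ≡⟨ Interleave-countAtMost y il ⟩
  countAtMost y xs + countAtMost y ys          ≡⟨ cong (_+ countAtMost y ys) (countAtMost-reject x≰y) ⟨
  countAtMost y (x ∷ xs) + countAtMost y ys    ∎
  where open ≡-Reasoning
Interleave-countAtMost y {xs} {x ∷ ys} {x ∷ zs} (right il) with x ≤? y
... | yes x≤y = begin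
  countAtMost y (x ∷ zs)                       ≡⟨ countAtMost-accept x≤y ⟩
  suc (countAtMost y zs)                       ≡⟨ cong suc (Interleave-countAtMost y il) ⟩
  suc (countAtMost y xs + countAtMost y ys)    ≡⟨ +-suc (countAtMost y xs) _ ⟨
  countAtMost y xs + suc (countAtMost y ys)    ≡⟨ cong (λ n → countAtMost y xs + n) (countAtMost-accept x≤y) ⟨
  countAtMost y xs + countAtMost y (x ∷ ys)    ∎
  where open ≡-Reasoning
... | no x≰y = begin
  countAtMost y (x ∷ zs)                       ≡⟨ countAtMost-reject x≰y ⟩
  countAtMost y zs                             ≡⟨ Interleave-countAtMost y il ⟩
  countAtMost y xs + countAtMost y ys          ≡⟨ cong (λ n → countAtMost y xs + n) (countAtMost-reject x≰y) ⟨
  countAtMost y xs + countAtMost y (x ∷ ys)    ∎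
  where open ≡-Reasoning

s-at : ∀ x → s x x ≡ suc x
s-at x = if-T (≡⇒≡ᵇ x x refl)

s-at-suc : ∀ x → s x (suc x) ≡ x
s-at-suc x = trans (if-¬T (1+n≢n ∘ ≡ᵇ⇒≡ (suc x) x)) (if-T (≡⇒≡ᵇ x x refl))

s-fix : ∀ {x j} → j ≢ x → j ≢ suc x → s x j ≡ j
s-fix {x} {j} j≢x j≢1+x = trans (if-¬T (j≢x ∘ ≡ᵇ⇒≡ j x)) (if-¬T (j≢1+x ∘ ≡ᵇ⇒≡ j (suc x)))

s-below : ∀ {x j} → j < x → s x j ≡ j
s-below j<x = s-fix (<⇒≢ j<x) (<⇒≢ (m<n⇒m<1+n j<x))

s-above : ∀ {x j} → suc x < j → s x j ≡ j
s-above 1+x<j = s-fix (>⇒≢ (<-trans (n<1+n _) 1+x<j)) (>⇒≢ 1+x<j)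

s-involutive : ∀ x j → s x (s x j) ≡ j
s-involutive x j with j ℕ.≟ x | j ℕ.≟ suc x
... | yes refl | _        = trans (cong (s x) (s-at x)) (s-at-suc x)
... | no _     | yes refl = trans (cong (s x) (s-at-suc x)) (s-at x)
... | no j≢x   | no j≢1+x = trans (cong (s x) (s-fix j≢x j≢1+x)) (s-fix j≢x j≢1+x)

s-injective : ∀ x {j k} → s x j ≡ s x k → j ≡ k
s-injective x {j} {k} e = trans (sym (s-involutive x j)) (trans (cong (s x) e) (s-involutive x k))

s-preserves-> : ∀ {x j k} → j < x → j < k → j < s x k
s-preserves-> {x} {j} {k} j<x j<k with k ℕ.≟ x | k ℕ.≟ suc x
... | yes refl | _        = subst (j <_) (sym (s-at k)) (m<n⇒m<1+n j<k)
... | no _     | yes refl = subst (j <_) (sym (s-at-suc x)) j<x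
... | no k≢x   | no k≢1+x = subst (j <_) (sym (s-fix k≢x k≢1+x)) j<k

prod-++ : ∀ as bs j → prod (as ++ bs) j ≡ prod as (prod bs j)
prod-++ []       bs j = refl
prod-++ (a ∷ as) bs j = cong (s a) (prod-++ as bs j)

prod-∷ʳ : ∀ as x j → prod (as ∷ʳ x) j ≡ prod as (s x j)
prod-∷ʳ as x = prod-++ as [ x ]

count : (ℕ → Bool) → ℕ → ℕ
count P zero    = 0
count P (suc n) = count P n + indicator (P (suc n))

count-cong : ∀ {P Q} n → (∀ {j} → 1 ≤ j → j ≤ n → P j ≡ Q j) → count P n ≡ count Q n
count-cong zero    _   = refl
count-cong (suc n) P≡Q =
  cong₂ _+_ (count-cong n (λ 1≤j j≤n → P≡Q 1≤j (m≤n⇒m≤1+n j≤n))) (cong indicator (P≡Q (s≤s z≤n) ≤-refl))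

count-none : ∀ {P} n → (∀ {j} → 1 ≤ j → j ≤ n → ¬ T (P j)) → count P n ≡ 0
count-none zero    _  = refl
count-none (suc n) ¬P =
  cong₂ _+_ (count-none n (λ 1≤j j≤n → ¬P 1≤j (m≤n⇒m≤1+n j≤n))) (indicator-¬T (¬P (s≤s z≤n) ≤-refl))

count-∘s : ∀ P x' n → suc (suc x') ≤ n → count (P ∘ s (suc x')) n ≡ count P n
count-∘s P x' (suc n) (s≤s x<n) with m≤n⇒m<n∨m≡n x<n
... | inj₁ x<n' rewrite count-∘s P x' n x<n' | s-above {suc x'} (s≤s x<n') = refl
... | inj₂ refl rewrite count-cong {P ∘ s (suc x')} {P} x' (λ _ j≤x' → cong P (s-below (s≤s j≤x')))
                      | s-at (suc x') | s-at-suc (suc x') = xy∙z≈xz∙y (count P x') _ _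

inversionsAt : (ℕ → ℕ) → ℕ → ℕ
inversionsAt f zero    = 0
inversionsAt f (suc k) = count (λ j → f (suc k) <ᵇ f j) k

inversions : (ℕ → ℕ) → ℕ → ℕ
inversions f zero    = 0
inversions f (suc M) = inversions f M + inversionsAt f (suc M)

inversionsAt-cong : ∀ {f g} k → (∀ {j} → j ≤ k → f j ≡ g j) → inversionsAt f k ≡ inversionsAt g k
inversionsAt-cong zero    _   = refl
inversionsAt-cong (suc k) f≡g =
  count-cong k (λ _ j≤k → cong₂ _<ᵇ_ (f≡g ≤-refl) (f≡g (m≤n⇒m≤1+n j≤k)))

inversions-cong : ∀ {f g} M → (∀ {j} → j ≤ M → f j ≡ g j) → inversions f M ≡ inversions g M
inversions-cong zero    _   = refl
inversions-cong (suc M) f≡g =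
  cong₂ _+_ (inversions-cong M (f≡g ∘ m≤n⇒m≤1+n)) (inversionsAt-cong (suc M) f≡g)

inversions-id : ∀ M → inversions (λ j → j) M ≡ 0
inversions-id zero    = refl
inversions-id (suc M) =
  cong₂ _+_ (inversions-id M) (count-none M (λ _ j≤M h → <⇒≱ (<ᵇ⇒< (suc M) _ h) (m≤n⇒m≤1+n j≤M)))

inversions-∘s : ∀ f x' M → suc (suc x') ≤ M →
  inversions (f ∘ s (suc x')) M + indicator (f (suc (suc x')) <ᵇ f (suc x'))
    ≡ inversions f M + indicator (f (suc x') <ᵇ f (suc (suc x')))
inversions-∘s f x' (suc M) (s≤s x≤M) with m≤n⇒m<n∨m≡n x≤M
... | inj₁ x<M = begin
  inversions g M + inversionsAt g (suc M) + desc   ≡⟨ cong (λ n → inversions g M + n + desc) far ⟩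
  inversions g M + inversionsAt f (suc M) + desc   ≡⟨ xy∙z≈xz∙y (inversions g M) _ _ ⟩
  inversions g M + desc + inversionsAt f (suc M)   ≡⟨ cong (_+ inversionsAt f (suc M)) (inversions-∘s f x' M x<M) ⟩
  inversions f M + asc + inversionsAt f (suc M)    ≡⟨ xy∙z≈xz∙y (inversions f M) _ _ ⟩
  inversions f M + inversionsAt f (suc M) + asc    ∎
  where
  open ≡-Reasoning
  x = suc x'
  g = f ∘ s x
  desc = indicator (f (suc x) <ᵇ f x)
  asc  = indicator (f x <ᵇ f (suc x))
  far : inversionsAt g (suc M) ≡ inversionsAt f (suc M)
  far rewrite s-above {x} (s≤s x<M) = count-∘s (λ j → f (suc M) <ᵇ f j) x' M x<M
... | inj₂ refl = begin
  inversions g x' + inversionsAt g x + inversionsAt g (suc x) + desc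
    ≡⟨ cong₂ (λ m n → m + n + desc) (cong₂ _+_ low A-shift) (cong₂ _+_ B-shift swapped) ⟩
  inversions f x' + A + (B + asc) + desc
    ≡⟨ rearrange (inversions f x') A B asc desc ⟩
  inversions f x' + B + (A + desc) + asc ∎
  where
  open ≡-Reasoning
  x = suc x'
  g = f ∘ s x
  desc = indicator (f (suc x) <ᵇ f x)
  asc  = indicator (f x <ᵇ f (suc x))
  A = count (λ j → f (suc x) <ᵇ f j) x'
  B = inversionsAt f x
  low : inversions g x' ≡ inversions f x'
  low = inversions-cong x' (λ j≤x' → cong f (s-below (s≤s j≤x')))
  A-shift : inversionsAt g x ≡ A
  A-shift = count-cong x' (λ _ j≤x' → cong₂ _<ᵇ_ (cong f (s-at x)) (cong f (s-below (s≤s j≤x'))))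
  B-shift : count (λ j → g (suc x) <ᵇ g j) x' ≡ B
  B-shift = count-cong x' (λ _ j≤x' → cong₂ _<ᵇ_ (cong f (s-at-suc x)) (cong f (s-below (s≤s j≤x'))))
  swapped : indicator (g (suc x) <ᵇ g x) ≡ asc
  swapped = cong indicator (cong₂ _<ᵇ_ (cong f (s-at-suc x)) (cong f (s-at x)))
  rearrange : ∀ i a b c d → i + a + (b + c) + d ≡ i + b + (a + d) + c
  rearrange = solve-∀

inversions-∘s-≤ : ∀ f x' M → suc (suc x') ≤ M → inversions (f ∘ s (suc x')) M ≤ inversions f M + 1
inversions-∘s-≤ f x' M x<M = begin
  inversions (f ∘ s (suc x')) M                    ≤⟨ m≤m+n _ _ ⟩
  inversions (f ∘ s (suc x')) M + indicator desc   ≡⟨ inversions-∘s f x' M x<M ⟩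
  inversions f M + indicator asc                   ≤⟨ +-monoʳ-≤ (inversions f M) (indicator≤1 asc) ⟩
  inversions f M + 1                               ∎
  where
  open ≤-Reasoning
  desc = f (suc (suc x')) <ᵇ f (suc x')
  asc  = f (suc x') <ᵇ f (suc (suc x'))

inversions-∘s-descent : ∀ f x' M → suc (suc x') ≤ M → f (suc (suc x')) < f (suc x') →
  inversions (f ∘ s (suc x')) M + 1 ≡ inversions f M
inversions-∘s-descent f x' M x<M desc = begin
  inversions (f ∘ s (suc x')) M + 1
    ≡⟨ cong (λ n → inversions (f ∘ s (suc x')) M + n) (sym (indicator-T (<⇒<ᵇ desc))) ⟩
  inversions (f ∘ s (suc x')) M + indicator (f (suc (suc x')) <ᵇ f (suc x'))
    ≡⟨ inversions-∘s f x' M x<M ⟩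
  inversions f M + indicator (f (suc x') <ᵇ f (suc (suc x')))
    ≡⟨ cong (λ n → inversions f M + n) (indicator-¬T (<⇒≯ desc ∘ <ᵇ⇒< _ _)) ⟩
  inversions f M + 0
    ≡⟨ +-identityʳ _ ⟩
  inversions f M ∎
  where open ≡-Reasoning

inversions-∘s-ascent : ∀ f x' M → suc (suc x') ≤ M → f (suc x') < f (suc (suc x')) →
  inversions (f ∘ s (suc x')) M ≡ inversions f M + 1
inversions-∘s-ascent f x' M x<M asc = begin
  inversions (f ∘ s (suc x')) M
    ≡⟨ sym (+-identityʳ _) ⟩
  inversions (f ∘ s (suc x')) M + 0
    ≡⟨ cong (λ n → inversions (f ∘ s (suc x')) M + n) (sym (indicator-¬T (<⇒≯ asc ∘ <ᵇ⇒< _ _))) ⟩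
  inversions (f ∘ s (suc x')) M + indicator (f (suc (suc x')) <ᵇ f (suc x'))
    ≡⟨ inversions-∘s f x' M x<M ⟩
  inversions f M + indicator (f (suc x') <ᵇ f (suc (suc x')))
    ≡⟨ cong (λ n → inversions f M + n) (indicator-T (<⇒<ᵇ asc)) ⟩
  inversions f M + 1 ∎
  where open ≡-Reasoning

-- Coxeter length

record PermBelow (M : ℕ) (f : ℕ → ℕ) : Set where
  field
    fixes-zero  : f 0 ≡ 0
    injective   : ∀ {a b} → f a ≡ f b → a ≡ b
    fixes-above : ∀ {j} → M < j → f j ≡ j
open PermBelow

PermBelow-mono : ∀ {N M f} → N ≤ M → PermBelow N f → PermBelow M f
PermBelow-mono N≤M pf = record
  { fixes-zero = fixes-zero pf ; injective = injective pf ; fixes-above = fixes-above pf ∘ ≤-<-trans N≤M }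

PermBelow-∘s : ∀ {M f x'} → suc (suc x') ≤ M → PermBelow M f → PermBelow M (f ∘ s (suc x'))
PermBelow-∘s {f = f} x<M pf = record
  { fixes-zero  = fixes-zero pf
  ; injective   = s-injective _ ∘ injective pf
  ; fixes-above = λ M<j → trans (cong f (s-above (≤-<-trans x<M M<j))) (fixes-above pf M<j)
  }

PermBelow-bounded : ∀ {M f j} → PermBelow M f → j ≤ M → f j ≤ M
PermBelow-bounded {M} {f} {j} pf j≤M with ≤-<-connex (f j) M
... | inj₁ fj≤M = fj≤M
... | inj₂ M<fj = contradiction (≤-<-trans j≤M M<fj) (<-irrefl (sym (injective pf (fixes-above pf M<fj))))

PermBelow-positive : ∀ {M f j} → PermBelow M f → 1 ≤ j → 1 ≤ f j
PermBelow-positive {f = f} {j} pf 1≤j with f j in fj≡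
... | suc _ = s≤s z≤n
... | zero  = ⊥-elim (<⇒≢ 1≤j (sym (injective pf (trans fj≡ (sym (fixes-zero pf))))))

inversions-suc : ∀ {M f} → PermBelow M f → inversions f (suc M) ≡ inversions f M
inversions-suc {M} {f} pf = trans (cong (λ n → inversions f M + n) none) (+-identityʳ _)
  where
  none : inversionsAt f (suc M) ≡ 0
  none rewrite fixes-above pf (n<1+n M) =
    count-none M (λ _ j≤M h → <⇒≱ (<ᵇ⇒< (suc M) _ h) (m≤n⇒m≤1+n (PermBelow-bounded pf j≤M)))

inversions-stable : ∀ {N M f} → N ≤ M → PermBelow N f → inversions f M ≡ inversions f N
inversions-stable {N} {M} {f} N≤M pf = trans (cong (inversions f) (sym (m∸n+n≡m N≤M))) (go (M ∸ N))
  where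
  go : ∀ k → inversions f (k + N) ≡ inversions f N
  go zero    = refl
  go (suc k) = trans (inversions-suc (PermBelow-mono (m≤n+m N k) pf)) (go k)

inversions-prod≤length : ∀ {M as} → Letters as → All (_< M) as → inversions (prod as) M ≤ length as
inversions-prod≤length {M} {as} = go (reverseView as)
  where
  go : ∀ {as} → Reverse as → Letters as → All (_< M) as → inversions (prod as) M ≤ length as
  go []                  _       _    = ≤-reflexive (inversions-id M)
  go (bs ∶ view ∶ʳ suc x') letters as<M with All.∷ʳ⁻ letters | All.∷ʳ⁻ as<M
  ... | bs-letters , _ | bs<M , x<M = begin
    inversions (prod (bs ∷ʳ suc x')) M        ≡⟨ inversions-cong M (λ {j} _ → prod-∷ʳ bs (suc x') j) ⟩
    inversions (prod bs ∘ s (suc x')) M       ≤⟨ inversions-∘s-≤ (prod bs) x' M x<M ⟩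
    inversions (prod bs) M + 1                ≤⟨ +-monoˡ-≤ 1 (go view bs-letters bs<M) ⟩
    length bs + 1                             ≡⟨ sym (length-++ bs) ⟩
    length (bs ∷ʳ suc x')                     ∎
    where open ≤-Reasoning
  go (bs ∶ view ∶ʳ zero) letters _ with () ← All.∷ʳ⁻ letters

descent-or-increasing : ∀ (f : ℕ → ℕ) → (∀ {a b} → f a ≡ f b → a ≡ b) → ∀ M →
  (Σ[ x' ∈ ℕ ] (suc (suc x') ≤ M × f (suc (suc x')) < f (suc x'))) ⊎ (∀ {x} → 1 ≤ x → suc x ≤ M → f x < f (suc x))
descent-or-increasing f inj zero    = inj₂ (λ _ ())
descent-or-increasing f inj (suc M) with descent-or-increasing f inj M
... | inj₁ (x' , x<M , desc) = inj₁ (x' , m≤n⇒m≤1+n x<M , desc)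
descent-or-increasing f inj (suc zero) | inj₂ _ = inj₂ λ { (s≤s z≤n) (s≤s ()) }
descent-or-increasing f inj (suc (suc M)) | inj₂ incr with <-cmp (f (suc M)) (f (suc (suc M)))
... | tri< asc _ _  = inj₂ incr′
  where
  incr′ : ∀ {x} → 1 ≤ x → suc x ≤ suc (suc M) → f x < f (suc x)
  incr′ 1≤x x<2+M with m≤n⇒m<n∨m≡n x<2+M
  ... | inj₁ (s≤s x<1+M) = incr 1≤x x<1+M
  ... | inj₂ refl        = asc
... | tri≈ _ e _    = ⊥-elim (1+n≢n (sym (inj e)))
... | tri> _ _ desc = inj₁ (M , ≤-refl , desc)

increasing⇒id : ∀ {M f} → PermBelow M f → (∀ {x} → 1 ≤ x → suc x ≤ M → f x < f (suc x)) → ∀ j → f j ≡ j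
increasing⇒id pf incr zero = fixes-zero pf
increasing⇒id {M} {f} pf incr (suc j) with ≤-<-connex (suc j) M
... | inj₂ M<j  = fixes-above pf M<j
... | inj₁ j≤M = ≤-antisym (down (M ∸ suc j) (s≤s z≤n) (m+[n∸m]≡n j≤M)) (up j j≤M)
  where
  up : ∀ j → suc j ≤ M → suc j ≤ f (suc j)
  up zero    _   = PermBelow-positive pf (s≤s z≤n)
  up (suc j) j<M = ≤-<-trans (up j (<⇒≤ j<M)) (incr (s≤s z≤n) j<M)
  down : ∀ {j} d → 1 ≤ j → j + d ≡ M → f j ≤ j
  down {j} zero    _   refl = ≤-trans (PermBelow-bounded pf (m≤m+n j 0)) (≤-reflexive (+-identityʳ j))
  down {j} (suc d) 1≤j refl = <⇒≤pred (<-≤-trans (incr 1≤j (m<m+n j (s≤s z≤n))) (down d (s≤s z≤n) (sym (+-suc j d))))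

-- bubble sort: right multiplication by a descent transposition removes exactly one inversion
word-of-length-inversions : ∀ k {M f} → PermBelow M f → inversions f M ≡ k →
  ∃[ as ] (Letters as × (∀ j → prod as j ≡ f j) × length as ≡ k)
word-of-length-inversions k {M} {f} pf inv≡k with descent-or-increasing f (injective pf) M
... | inj₂ incr = [] , [] , (λ j → sym (increasing⇒id pf incr j)) , trans (sym no-inversions) inv≡k
  where
  no-inversions : inversions f M ≡ 0
  no-inversions = trans (inversions-cong M (λ {j} _ → increasing⇒id pf incr j)) (inversions-id M)
... | inj₁ (x' , x<M , desc) with k | trans (+-comm 1 _) (trans (inversions-∘s-descent f x' M x<M desc) inv≡k)
...   | zero  | ()
...   | suc k | fewer with word-of-length-inversions k (PermBelow-∘s x<M pf) (suc-injective fewer)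
...     | as , letters , prod-as , length-as =
  as ∷ʳ suc x' ,
  All.∷ʳ⁺ letters (s≤s z≤n) ,
  (λ j → trans (prod-∷ʳ as (suc x') j) (trans (prod-as (s (suc x') j)) (cong f (s-involutive (suc x') j)))) ,
  trans (length-++ as) (trans (+-comm (length as) 1) (cong suc length-as))

∃-strict-upper-bound : ∀ as → ∃[ M ] All (_< M) as
∃-strict-upper-bound []       = 0 , []
∃-strict-upper-bound (a ∷ as) with ∃-strict-upper-bound as
... | M , as<M = suc a ⊔ M , m≤m⊔n (suc a) M ∷ All.map (λ a<M → ≤-trans a<M (m≤n⊔m (suc a) M)) as<M

bound : FinPerm → ℕ
bound w = proj₁ (support w)

FinPerm-PermBelow : ∀ w → PermBelow (bound w) (fn w)
FinPerm-PermBelow w = record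
  { fixes-zero = fix0 w ; injective = inj w _ _ ; fixes-above = proj₂ (support w) _ }

ℓ : FinPerm → ℕ
ℓ w = inversions (fn w) (bound w)

ℓ≤length : ∀ w {as} → IsWordFor w as → ℓ w ≤ length as
ℓ≤length w {as} (letters , prod≡w) = begin
  ℓ w                     ≡⟨ inversions-stable (m≤m⊔n (bound w) M) (FinPerm-PermBelow w) ⟨
  inversions (fn w) M′    ≡⟨ inversions-cong M′ (λ {j} _ → prod≡w j) ⟨
  inversions (prod as) M′ ≤⟨ inversions-prod≤length letters as<M′ ⟩
  length as               ∎
  where
  open ≤-Reasoning
  M = proj₁ (∃-strict-upper-bound as)
  M′ = bound w ⊔ M
  as<M′ = All.map (λ a<M → ≤-trans a<M (m≤n⊔m (bound w) M)) (proj₂ (∃-strict-upper-bound as))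

∃-word-of-length-ℓ : ∀ w → ∃[ as ] (IsWordFor w as × length as ≡ ℓ w)
∃-word-of-length-ℓ w with word-of-length-inversions (ℓ w) (FinPerm-PermBelow w) refl
... | as , letters , prod≡w , length≡ℓ = as , (letters , prod≡w) , length≡ℓ

length≡ℓ⇒reduced : ∀ w {as} → IsWordFor w as → length as ≡ ℓ w → IsReducedWord w as
length≡ℓ⇒reduced w word length≡ℓ = word , λ _ word′ → ≤-trans (≤-reflexive length≡ℓ) (ℓ≤length w word′)

reduced⇒length≡ℓ : ∀ w {as} → IsReducedWord w as → length as ≡ ℓ w
reduced⇒length≡ℓ w (word , minimal) with ∃-word-of-length-ℓ w
... | bs , word′ , length≡ℓ = ≤-antisym (≤-trans (minimal bs word′) (≤-reflexive length≡ℓ)) (ℓ≤length w word)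

-- w ·s⟨1+ x ⟩ is w s_{x+1}: letters of words are positive, and s_0 would move the padding point 0
_·s⟨1+_⟩ : FinPerm → ℕ → FinPerm
w ·s⟨1+ x ⟩ = record
  { fn      = fn w ∘ s (suc x)
  ; fix0    = fix0 w
  ; inj     = λ a b → s-injective (suc x) ∘ inj w _ _
  ; surj    = λ b → s (suc x) (proj₁ (surj w b)) , trans (cong (fn w) (s-involutive (suc x) _)) (proj₂ (surj w b))
  ; support = bound w ⊔ suc (suc x) , λ j M<j →
      trans (cong (fn w) (s-above (≤-<-trans (m≤n⊔m (bound w) _) M<j))) (proj₂ (support w) j (≤-<-trans (m≤m⊔n _ _) M<j))
  }

ℓ-·s-descent : ∀ {w x} → fn w (suc (suc x)) < fn w (suc x) → ℓ (w ·s⟨1+ x ⟩) + 1 ≡ ℓ w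
ℓ-·s-descent {w} {x} desc =
  trans (inversions-∘s-descent (fn w) x _ (m≤n⊔m (bound w) _) desc)
        (inversions-stable (m≤m⊔n (bound w) _) (FinPerm-PermBelow w))

ℓ-·s-ascent : ∀ {w x} → fn w (suc x) < fn w (suc (suc x)) → ℓ (w ·s⟨1+ x ⟩) ≡ ℓ w + 1
ℓ-·s-ascent {w} {x} asc =
  trans (inversions-∘s-ascent (fn w) x _ (m≤n⊔m (bound w) _) asc)
        (cong (_+ 1) (inversions-stable (m≤m⊔n (bound w) _) (FinPerm-PermBelow w)))

word-·s : ∀ w {as x} → IsWordFor w (as ∷ʳ suc x) → IsWordFor (w ·s⟨1+ x ⟩) as
word-·s w {as} {x} (letters , prod≡w) = proj₁ (All.∷ʳ⁻ letters) , λ j → begin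
  prod as j                       ≡⟨ cong (prod as) (s-involutive (suc x) j) ⟨
  prod as (s (suc x) (s (suc x) j)) ≡⟨ prod-∷ʳ as (suc x) _ ⟨
  prod (as ∷ʳ suc x) (s (suc x) j) ≡⟨ prod≡w _ ⟩
  fn w (s (suc x) j)              ∎
  where open ≡-Reasoning

reduced-∷ʳ⇒descent : ∀ w {as x} → IsReducedWord w (as ∷ʳ suc x) → fn w (suc (suc x)) < fn w (suc x)
reduced-∷ʳ⇒descent w {as} {x} reduced@(word , _) with <-cmp (fn w (suc (suc x))) (fn w (suc x))
... | tri< desc _ _ = desc
... | tri≈ _ e _    = ⊥-elim (1+n≢n (inj w _ _ e))
... | tri> _ _ asc  = ⊥-elim (<-irrefl refl (begin-strict
  length as                 <⟨ m<m+n (length as) (s≤s z≤n) ⟩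
  length as + 1             ≡⟨ length-++ as ⟨
  length (as ∷ʳ suc x)      ≡⟨ reduced⇒length≡ℓ w reduced ⟩
  ℓ w                       <⟨ m<m+n (ℓ w) (s≤s z≤n) ⟩
  ℓ w + 1                   ≡⟨ ℓ-·s-ascent {w} {x} asc ⟨
  ℓ (w ·s⟨1+ x ⟩)           ≤⟨ ℓ≤length (w ·s⟨1+ x ⟩) (word-·s w word) ⟩
  length as                 ∎))
  where open ≤-Reasoning

reduced-∷ʳ⇒reduced-·s : ∀ w {as x} → IsReducedWord w (as ∷ʳ suc x) → IsReducedWord (w ·s⟨1+ x ⟩) as
reduced-∷ʳ⇒reduced-·s w {as} {x} reduced@(word , _) =
  length≡ℓ⇒reduced (w ·s⟨1+ x ⟩) (word-·s w word) (+-cancelʳ-≡ _ _ _ (begin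
  length as + 1        ≡⟨ length-++ as ⟨
  length (as ∷ʳ suc x) ≡⟨ reduced⇒length≡ℓ w reduced ⟩
  ℓ w                  ≡⟨ ℓ-·s-descent {w} {x} (reduced-∷ʳ⇒descent w reduced) ⟨
  ℓ (w ·s⟨1+ x ⟩) + 1  ∎))
  where open ≡-Reasoning

reduced-·s⇒reduced-∷ʳ : ∀ w {as x} → IsReducedWord (w ·s⟨1+ x ⟩) as → fn w (suc (suc x)) < fn w (suc x) →
  IsReducedWord w (as ∷ʳ suc x)
reduced-·s⇒reduced-∷ʳ w {as} {x} reduced@((letters , prod≡ws) , _) desc = length≡ℓ⇒reduced w word (begin
  length (as ∷ʳ suc x) ≡⟨ length-++ as ⟩
  length as + 1        ≡⟨ cong (_+ 1) (reduced⇒length≡ℓ (w ·s⟨1+ x ⟩) reduced) ⟩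
  ℓ (w ·s⟨1+ x ⟩) + 1  ≡⟨ ℓ-·s-descent {w} {x} desc ⟩
  ℓ w                  ∎)
  where
  open ≡-Reasoning
  word : IsWordFor w (as ∷ʳ suc x)
  word = All.∷ʳ⁺ letters (s≤s z≤n) , λ j →
    trans (prod-∷ʳ as (suc x) j) (trans (prod≡ws _) (cong (fn w) (s-involutive (suc x) j)))

Theta-·s : ∀ {w x j} → j ≤ x → Theta w j → Theta (w ·s⟨1+ x ⟩) j
Theta-·s {w} {x} {j} j≤x (k , j<k , wk<wj) =
  s (suc x) k , s-preserves-> (s≤s j≤x) j<k ,
  subst₂ _<_ (cong (fn w) (sym (s-involutive (suc x) k))) (cong (fn w) (sym (s-below (s≤s j≤x)))) wk<wj

Theta-·s⁻ : ∀ {w x j} → j ≤ x → Theta (w ·s⟨1+ x ⟩) j → Theta w j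
Theta-·s⁻ {w} {x} {j} j≤x (k , j<k , wsk<wsj) =
  s (suc x) k , s-preserves-> (s≤s j≤x) j<k , subst (fn w (s (suc x) k) <_) (cong (fn w) (s-below (s≤s j≤x))) wsk<wsj

Lambda-·s : ∀ {w x i c} → i ≤ x → Lambda w i c → Lambda (w ·s⟨1+ x ⟩) i c
Lambda-·s         _   lam0           = lam0
Lambda-·s {w} {x} i≤x (lamYes λi θ)  = lamYes (Lambda-·s (<⇒≤ i≤x) λi) (Theta-·s {w} {x} i≤x θ)
Lambda-·s {w} {x} i≤x (lamNo  λi ¬θ) = lamNo  (Lambda-·s (<⇒≤ i≤x) λi) (¬θ ∘ Theta-·s⁻ {w} {x} i≤x)

Lambda-functional : ∀ {w i c c′} → Lambda w i c → Lambda w i c′ → c ≡ c′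
Lambda-functional lam0          lam0           = refl
Lambda-functional (lamYes λi _) (lamYes λi′ _) = cong suc (Lambda-functional λi λi′)
Lambda-functional (lamYes _ θ)  (lamNo _ ¬θ)   = ⊥-elim (¬θ θ)
Lambda-functional (lamNo _ ¬θ)  (lamYes _ θ)   = ⊥-elim (¬θ θ)
Lambda-functional (lamNo λi _)  (lamNo λi′ _)  = Lambda-functional λi λi′

Lambda-mono : ∀ {w x y c} → x ≤ y → Lambda w y c → ∃[ c′ ] (c′ ≤ c × Lambda w x c′)
Lambda-mono {c = c} x≤y λy with m≤n⇒m<n∨m≡n x≤y
... | inj₂ refl = c , ≤-refl , λy
Lambda-mono x≤y (lamYes λy _) | inj₁ (s≤s x≤y′) with Lambda-mono x≤y′ λy
... | c′ , c′≤c , λx = c′ , m≤n⇒m≤1+n c′≤c , λx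
Lambda-mono x≤y (lamNo λy _)  | inj₁ (s≤s x≤y′) = Lambda-mono x≤y′ λy

Lambda-Theta⁻ : ∀ {w x c} → Lambda w (suc x) c → Theta w (suc x) → ∃[ c′ ] (c ≡ suc c′ × Lambda w x c′)
Lambda-Theta⁻ (lamYes λx _) _ = _ , refl , λx
Lambda-Theta⁻ (lamNo _ ¬θ)  θ = ⊥-elim (¬θ θ)

descent⇒Theta : ∀ {w x} → fn w (suc x) < fn w x → Theta w x
descent⇒Theta {x = x} desc = suc x , n<1+n x , desc

Theta⇒descent : ∀ {w x} → Theta w x → ¬ Theta w (suc x) → fn w (suc x) < fn w x
Theta⇒descent {w} {x} (k , x<k , wk<wx) ¬θ with m≤n⇒m<n∨m≡n x<k
... | inj₂ refl = wk<wx
... | inj₁ 1+x<k with <-cmp (fn w k) (fn w (suc x))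
...   | tri< wk<w1+x _ _ = ⊥-elim (¬θ (k , 1+x<k , wk<w1+x))
...   | tri≈ _ e _       = subst (_< fn w x) e wk<wx
...   | tri> _ _ w1+x<wk = <-trans w1+x<wk wk<wx

¬Theta-·s : ∀ {w x} → Theta w (suc x) → ¬ Theta w (suc (suc x)) → ¬ Theta (w ·s⟨1+ x ⟩) (suc x)
¬Theta-·s {w} {x} θ ¬θ (k , 1+x<k , w<) with m≤n⇒m<n∨m≡n 1+x<k
... | inj₂ refl rewrite s-at-suc (suc x) | s-at (suc x) = <-asym w< (Theta⇒descent {w} θ ¬θ)
... | inj₁ 2+x<k rewrite s-above {suc x} 2+x<k | s-at (suc x) = ¬θ (k , 2+x<k , w<)

¬Theta-above-bound : ∀ {w j} → bound w < j → ¬ Theta w j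
¬Theta-above-bound {w} {j} M<j (k , j<k , wk<wj) =
  <-asym j<k (subst₂ _<_ (proj₂ (support w) k (<-trans M<j j<k)) (proj₂ (support w) j M<j) wk<wj)

Theta? : ∀ w j → Dec (Theta w j)
Theta? w j = map′ from-bounded to-bounded (anyUpTo? (λ k → (j <? k) ×-dec (fn w k <? fn w j)) (suc M))
  where
  M = bound w ⊔ fn w j
  from-bounded : (∃ λ k → k < suc M × j < k × fn w k < fn w j) → Theta w j
  from-bounded (k , _ , θ) = k , θ
  to-bounded : Theta w j → ∃ λ k → k < suc M × j < k × fn w k < fn w j
  to-bounded (k , j<k , wk<wj) with ≤-<-connex k M
  ... | inj₁ k≤M = k , s≤s k≤M , j<k , wk<wj
  ... | inj₂ M<k = ⊥-elim (<-asym wk<wj (subst (fn w j <_)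
                      (sym (proj₂ (support w) k (≤-<-trans (m≤m⊔n _ _) M<k))) (≤-<-trans (m≤n⊔m _ _) M<k)))

lambda : FinPerm → ℕ → ℕ
lambda w zero    = 0
lambda w (suc i) with Theta? w (suc i)
... | yes _ = suc (lambda w i)
... | no  _ = lambda w i

Lambda-lambda : ∀ w i → Lambda w i (lambda w i)
Lambda-lambda w zero    = lam0
Lambda-lambda w (suc i) with Theta? w (suc i)
... | yes θ  = lamYes (Lambda-lambda w i) θ
... | no  ¬θ = lamNo  (Lambda-lambda w i) ¬θ

lambda-suc-¬Theta : ∀ w i → ¬ Theta w (suc i) → lambda w (suc i) ≡ lambda w i
lambda-suc-¬Theta w i ¬θ with Theta? w (suc i)
... | yes θ = ⊥-elim (¬θ θ)
... | no  _ = refl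

lambda-suc-Theta : ∀ w i → Theta w (suc i) → lambda w (suc i) ≡ suc (lambda w i)
lambda-suc-Theta w i θ with Theta? w (suc i)
... | yes _  = refl
... | no  ¬θ = ⊥-elim (¬θ θ)

lambda-≤-suc : ∀ w i → lambda w i ≤ lambda w (suc i)
lambda-≤-suc w i with Theta? w (suc i)
... | yes _ = n≤1+n _
... | no  _ = ≤-refl

-- Increasing suffixes of reduced words

-- the last letter x of the suffix is a descent of w, so θ_x(w) = 1, and the letters before it are < x
countAtMost-increasing-suffix : ∀ w {as} τ → AllPairs _<_ τ → IsReducedWord w (as ++ τ) →
  ∀ {y c} → Lambda w y c → countAtMost y τ ≤ c
countAtMost-increasing-suffix w τ = go (reverseView τ)
  where
  go : ∀ {w as τ} → Reverse τ → AllPairs _<_ τ → IsReducedWord w (as ++ τ) →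
       ∀ {y c} → Lambda w y c → countAtMost y τ ≤ c
  go [] _ _ _ = z≤n
  go {w} {as} (τ ∶ view ∶ʳ x) increasing reduced {y} {c} λy
    with subst (IsReducedWord w) (sym (++-assoc as τ [ x ])) reduced | AllPairs-++⁻ˡ τ increasing
  ... | reduced′ | τ-increasing with proj₂ (All.∷ʳ⁻ (proj₁ (proj₁ reduced′))) | x ≤? y
  ...   | s≤s {n = x'} z≤n | no x≰y = begin
    countAtMost y (τ ∷ʳ suc x')      ≡⟨ countAtMost-++ y τ [ suc x' ] ⟩
    countAtMost y τ + countAtMost y [ suc x' ] ≡⟨ cong (λ n → countAtMost y τ + n) (countAtMost-reject x≰y) ⟩
    countAtMost y τ + 0              ≡⟨ +-identityʳ _ ⟩
    countAtMost y τ                  ≤⟨ go view τ-increasing reduced-·s (Lambda-·s (≤-pred (≰⇒> x≰y)) λy) ⟩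
    c                                ∎
    where
    open ≤-Reasoning
    reduced-·s = reduced-∷ʳ⇒reduced-·s w reduced′
  ...   | s≤s {n = x'} z≤n | yes x≤y with Lambda-mono x≤y λy
  ...     | c₁ , c₁≤c , λx with Lambda-Theta⁻ λx (descent⇒Theta {w} (reduced-∷ʳ⇒descent w reduced′))
  ...       | c₂ , refl , λx' = begin
    countAtMost y (τ ∷ʳ suc x')      ≡⟨ countAtMost-++ y τ [ suc x' ] ⟩
    countAtMost y τ + countAtMost y [ suc x' ] ≡⟨ cong (λ n → countAtMost y τ + n) (countAtMost-accept x≤y) ⟩
    countAtMost y τ + 1              ≤⟨ +-monoˡ-≤ 1 (length-filter (_≤? y) τ) ⟩
    length τ + 1                     ≡⟨ cong (_+ 1) (countAtMost-all (All.map ≤-pred (AllPairs-before τ increasing))) ⟨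
    countAtMost x' τ + 1             ≤⟨ +-monoˡ-≤ 1 (go view τ-increasing reduced-·s (Lambda-·s ≤-refl λx')) ⟩
    c₂ + 1                           ≡⟨ +-comm c₂ 1 ⟩
    suc c₂                           ≤⟨ c₁≤c ⟩
    c                                ∎
    where
    open ≤-Reasoning
    reduced-·s = reduced-∷ʳ⇒reduced-·s w reduced′

∃-increasing-suffix : ∀ i w → ¬ Theta w (suc i) → ∀ {c} → Lambda w i c →
  ∃[ as ] ∃[ τ ] (IsReducedWord w (as ++ τ) × AllPairs _<_ τ × All (_≤ i) τ × length τ ≡ c)
∃-increasing-suffix zero w _ lam0 with ∃-word-of-length-ℓ w
... | as , word , length≡ℓ =
  as , [] , subst (IsReducedWord w) (sym (++-identityʳ as)) (length≡ℓ⇒reduced w word length≡ℓ) , [] , [] , refl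
∃-increasing-suffix (suc i) w _ (lamNo λi ¬θ) with ∃-increasing-suffix i w ¬θ λi
... | as , τ , reduced , increasing , τ≤i , length-τ = as , τ , reduced , increasing , All.map m≤n⇒m≤1+n τ≤i , length-τ
∃-increasing-suffix (suc i) w ¬θ′ (lamYes λi θ)
  with ∃-increasing-suffix i (w ·s⟨1+ i ⟩) (¬Theta-·s {w} θ ¬θ′) (Lambda-·s ≤-refl λi)
... | as , τ , reduced , increasing , τ≤i , length-τ =
  as , τ ∷ʳ suc i ,
  subst (IsReducedWord w) (++-assoc as τ [ suc i ]) (reduced-·s⇒reduced-∷ʳ w reduced (Theta⇒descent {w} θ ¬θ′)) ,
  AllPairs.++⁺ increasing ([] ∷ []) (All.map (λ τⱼ≤i → s≤s τⱼ≤i ∷ []) τ≤i) ,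
  All.∷ʳ⁺ (All.map m≤n⇒m≤1+n τ≤i) ≤-refl ,
  trans (length-++ τ) (trans (+-comm (length τ) 1) (cong suc length-τ))

module _ {A : Set} (lt : A → A → Bool) where

  private
    _≺_ : A → A → Set
    a ≺ b = T (lt a b)

  decPre-∷ : ∀ x q → ∃[ r ] (decPre lt (x ∷ q) ≡ x ∷ r)
  decPre-∷ x []      = [] , refl
  decPre-∷ x (y ∷ q) with lt y x
  ... | true  = _ , refl
  ... | false = [] , refl

  decPre-Linked : ∀ {V} → Linked (flip _≺_) V → decPre lt V ≡ V
  decPre-Linked []            = refl
  decPre-Linked [-]           = refl
  decPre-Linked (y≺x ∷ rest) = trans (if-T y≺x) (cong (_ ∷_) (decPre-Linked rest))

  decPre-Linked-break : ∀ V {v y rest} → Linked (flip _≺_) (V ∷ʳ v) → ¬ y ≺ v →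
    decPre lt ((V ∷ʳ v) ++ y ∷ rest) ≡ V ∷ʳ v
  decPre-Linked-break []          _             y⊀v = if-¬T y⊀v
  decPre-Linked-break (a ∷ [])    {rest = R} (v≺a ∷ _)  y⊀v =
    trans (if-T v≺a) (cong (a ∷_) (decPre-Linked-break [] {rest = R} [-] y⊀v))
  decPre-Linked-break (a ∷ b ∷ V) {rest = R} (b≺a ∷ l) y⊀v =
    trans (if-T b≺a) (cong (a ∷_) (decPre-Linked-break (b ∷ V) {rest = R} l y⊀v))

  decPre-Linked-++ : ∀ V R → Linked (flip _≺_) V → length V ≤ length (decPre lt (V ++ R))
  decPre-Linked-++ []          R _ = z≤n
  decPre-Linked-++ (v ∷ [])    R _ rewrite proj₂ (decPre-∷ v R) = s≤s z≤n
  decPre-Linked-++ (a ∷ b ∷ V) R (b≺a ∷ rest) =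
    ≤-trans (s≤s (decPre-Linked-++ (b ∷ V) R rest)) (≤-reflexive (cong length (sym (if-T b≺a))))

  incSuf-Linked-id : ∀ {W} → Linked _≺_ W → incSuf lt W ≡ W
  incSuf-Linked-id {W} increasing =
    trans (cong reverse (decPre-Linked (Linked-reverse W increasing))) (reverse-involutive W)

  incSuf-break : ∀ Z h w W → Linked _≺_ (w ∷ W) → ¬ h ≺ w → incSuf lt (Z ++ h ∷ w ∷ W) ≡ w ∷ W
  incSuf-break Z h w W increasing h⊀w = begin
    reverse (decPre lt (reverse (Z ++ h ∷ w ∷ W)))          ≡⟨ cong (reverse ∘ decPre lt) reversed ⟩
    reverse (decPre lt ((reverse W ∷ʳ w) ++ h ∷ reverse Z))
      ≡⟨ cong reverse (decPre-Linked-break (reverse W) (Linked-reverse-∷ W increasing) h⊀w) ⟩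
    reverse (reverse W ∷ʳ w)                                 ≡⟨ cong reverse (unfold-reverse w W) ⟨
    reverse (reverse (w ∷ W))                                ≡⟨ reverse-involutive (w ∷ W) ⟩
    w ∷ W                                                    ∎
    where
    open ≡-Reasoning
    reversed : reverse (Z ++ h ∷ w ∷ W) ≡ (reverse W ∷ʳ w) ++ h ∷ reverse Z
    reversed = begin
      reverse (Z ++ h ∷ w ∷ W)          ≡⟨ reverse-++ Z (h ∷ w ∷ W) ⟩
      reverse (h ∷ w ∷ W) ++ reverse Z  ≡⟨ cong (_++ reverse Z) (unfold-reverse h (w ∷ W)) ⟩
      (reverse (w ∷ W) ∷ʳ h) ++ reverse Z ≡⟨ ++-assoc (reverse (w ∷ W)) [ h ] (reverse Z) ⟩
      reverse (w ∷ W) ++ h ∷ reverse Z  ≡⟨ cong (_++ h ∷ reverse Z) (unfold-reverse w W) ⟩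
      (reverse W ∷ʳ w) ++ h ∷ reverse Z ∎

  length≤incSuf-++ : ∀ P {S} → Linked _≺_ S → length S ≤ length (incSuf lt (P ++ S))
  length≤incSuf-++ P {S} increasing = begin
    length S                                    ≡⟨ length-reverse S ⟨
    length (reverse S)                          ≤⟨ decPre-Linked-++ (reverse S) (reverse P) (Linked-reverse S increasing) ⟩
    length (decPre lt (reverse S ++ reverse P)) ≡⟨ cong (length ∘ decPre lt) (reverse-++ P S) ⟨
    length (decPre lt (reverse (P ++ S)))       ≡⟨ length-reverse (decPre lt (reverse (P ++ S))) ⟨
    length (incSuf lt (P ++ S))                 ∎
    where open ≤-Reasoning

  incSuf-∷ʳ : ∀ q t → ∃[ S ] (incSuf lt (q ∷ʳ t) ≡ S ∷ʳ t)
  incSuf-∷ʳ q t with decPre-∷ t (reverse q)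
  ... | r , decPre≡ = reverse r , (begin
    reverse (decPre lt (reverse (q ∷ʳ t))) ≡⟨ cong (reverse ∘ decPre lt) (reverse-++ q [ t ]) ⟩
    reverse (decPre lt (t ∷ reverse q))    ≡⟨ cong reverse decPre≡ ⟩
    reverse (t ∷ r)                        ≡⟨ unfold-reverse t r ⟩
    reverse r ∷ʳ t                         ∎)
    where open ≡-Reasoning

  data IncSufView : List A → Set where
    whole : ∀ {W} → Linked _≺_ W → IncSufView W
    break : ∀ Z h w W → Linked _≺_ (w ∷ W) → ¬ h ≺ w → IncSufView (Z ++ h ∷ w ∷ W)

  incSufView : ∀ p → IncSufView p
  incSufView []      = whole []
  incSufView (x ∷ p) with incSufView p
  ... | break Z h w W increasing h⊀w = break (x ∷ Z) h w W increasing h⊀w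
  ... | whole {[]}    _          = whole [-]
  ... | whole {y ∷ W} increasing with T? (lt x y)
  ...   | yes x≺y = whole (x≺y ∷ increasing)
  ...   | no  x⊀y = break [] x y W increasing x⊀y

  incSuf-suffix : ∀ p → ∃[ P ] (p ≡ P ++ incSuf lt p)
  incSuf-suffix p with incSufView p
  ... | whole increasing = [] , sym (incSuf-Linked-id increasing)
  ... | break Z h w W increasing h⊀w = Z ∷ʳ h , (begin
    Z ++ h ∷ w ∷ W          ≡⟨ ++-assoc Z [ h ] (w ∷ W) ⟨
    (Z ∷ʳ h) ++ w ∷ W       ≡⟨ cong ((Z ∷ʳ h) ++_) (incSuf-break Z h w W increasing h⊀w) ⟨
    (Z ∷ʳ h) ++ incSuf lt (Z ++ h ∷ w ∷ W) ∎)
    where open ≡-Reasoning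

  incSuf-Linked : ∀ p → Linked _≺_ (incSuf lt p)
  incSuf-Linked p with incSufView p
  ... | whole increasing = subst (Linked _≺_) (sym (incSuf-Linked-id increasing)) increasing
  ... | break Z h w W increasing h⊀w = subst (Linked _≺_) (sym (incSuf-break Z h w W increasing h⊀w)) increasing

data _≺ᶜ_ : CLetter → CLetter → Set where
  val<   : ∀ {a b c d} → a < b → (a , c) ≺ᶜ (b , d)
  color< : ∀ {a c d} → c < d → (a , c) ≺ᶜ (a , d)

≺ᶜ⇒<ᶜ : ∀ {x y} → x ≺ᶜ y → T (x <ᶜ y)
≺ᶜ⇒<ᶜ (val< a<b)          = from T-∨ (inj₁ (<⇒<ᵇ a<b))
≺ᶜ⇒<ᶜ (color< {a} c<d) = from T-∨ (inj₂ (from T-∧ (≡⇒≡ᵇ a a refl , <⇒<ᵇ c<d)))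

<ᶜ⇒≺ᶜ : ∀ {x y} → T (x <ᶜ y) → x ≺ᶜ y
<ᶜ⇒≺ᶜ {a , c} {b , d} x<y with to T-∨ x<y
... | inj₁ a<b = val< (<ᵇ⇒< a b a<b)
... | inj₂ a≡b∧c<d with to T-∧ a≡b∧c<d
...   | a≡b , c<d with ≡ᵇ⇒≡ a b a≡b
...     | refl = color< (<ᵇ⇒< c d c<d)

≺ᶜ⇒val≤ : ∀ {x y} → x ≺ᶜ y → val x ≤ val y
≺ᶜ⇒val≤ (val< a<b)  = <⇒≤ a<b
≺ᶜ⇒val≤ (color< _) = ≤-refl

≺ᶜ-same-color : ∀ {a b c} → (a , c) ≺ᶜ (b , c) → a < b
≺ᶜ-same-color (val< a<b)   = a<b
≺ᶜ-same-color (color< c<c) = ⊥-elim (<-irrefl refl c<c)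

val≤⇒≺ᶜ : ∀ {a b} → a ≤ b → (a , 1) ≺ᶜ (b , 2)
val≤⇒≺ᶜ a≤b with m≤n⇒m<n∨m≡n a≤b
... | inj₁ a<b  = val< a<b
... | inj₂ refl = color< (s≤s (s≤s z≤n))

≺ᶜ-trans : ∀ {x y z} → x ≺ᶜ y → y ≺ᶜ z → x ≺ᶜ z
≺ᶜ-trans (val< a<b)   (val< b<c)   = val< (<-trans a<b b<c)
≺ᶜ-trans (val< a<b)   (color< _)   = val< a<b
≺ᶜ-trans (color< _)   (val< b<c)   = val< b<c
≺ᶜ-trans (color< c<d) (color< d<e) = color< (<-trans c<d d<e)

val-color : ∀ c xs → map val (color c xs) ≡ xs
val-color c xs = trans (sym (map-∘ xs)) (map-id xs)

color-increasing : ∀ c {xs} → AllPairs _<_ xs → AllPairs _≺ᶜ_ (color c xs)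
color-increasing c = AllPairs.map⁺ ∘ AllPairs.map val<

color-increasing⁻ : ∀ c {xs} → AllPairs _≺ᶜ_ (color c xs) → AllPairs _<_ xs
color-increasing⁻ c = AllPairs.map ≺ᶜ-same-color ∘ AllPairs.map⁻

Linked⇒val≤last : ∀ xs {t} → Linked _≺ᶜ_ (xs ∷ʳ t) → All (λ a → val a ≤ val t) (xs ∷ʳ t)
Linked⇒val≤last xs increasing =
  All.∷ʳ⁺ (All.map ≺ᶜ⇒val≤ (AllPairs-before xs (Linked⇒AllPairs ≺ᶜ-trans increasing))) ≤-refl

-- Increasing suffixes of shuffles

countAtMost-colored-suffix : ∀ w c {as A₁ A₂} → IsReducedWord w as → color c as ≡ A₁ ++ A₂ → AllPairs _≺ᶜ_ A₂ →
  ∀ {y cw} → Lambda w y cw → countAtMost y (map val A₂) ≤ cw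
countAtMost-colored-suffix w c {as} {A₁} {A₂} reduced as≡ increasing {y} λw with map-++⁻ (λ x → (x , c)) as {A₁} {A₂} as≡
... | as₁ , τ , refl , _ , refl =
  subst (_≤ _) (cong (countAtMost y) (sym (val-color c τ)))
    (countAtMost-increasing-suffix w τ (color-increasing⁻ c increasing) reduced λw)

countAtMost-increasing-suffix-Sch : ∀ {u v} P {S} → InSchProd u v (P ++ S) → AllPairs _≺ᶜ_ S →
  ∀ {y cu cv} → Lambda u y cu → Lambda v y cv → countAtMost y (map val S) ≤ cu + cv
countAtMost-increasing-suffix-Sch {u} {v} P {S} (a , b , reduced-a , reduced-b , il) increasing {y} {cu} {cv} λu λv
  with Interleave-suffix P il
... | A₁ , A₂ , B₁ , B₂ , a≡ , b≡ , il₂ = begin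
  countAtMost y (map val S)                               ≡⟨ Interleave-countAtMost y (Interleave-map val il₂) ⟩
  countAtMost y (map val A₂) + countAtMost y (map val B₂)
    ≤⟨ +-mono-≤ (countAtMost-colored-suffix u 1 reduced-a a≡ A₂-increasing λu)
                (countAtMost-colored-suffix v 2 reduced-b b≡ B₂-increasing λv) ⟩
  cu + cv                                                 ∎
  where
  open ≤-Reasoning
  A₂-increasing = proj₁ (Interleave-AllPairs il₂ increasing)
  B₂-increasing = proj₂ (Interleave-AllPairs il₂ increasing)

incSuf-increasing : ∀ p → Linked _≺ᶜ_ (incSuf _<ᶜ_ p)
incSuf-increasing p = Linked.map <ᶜ⇒≺ᶜ (incSuf-Linked _<ᶜ_ p)

countAtMost-incSuf-Sch : ∀ {u v p} → InSchProd u v p → ∀ {y cu cv} → Lambda u y cu → Lambda v y cv →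
  countAtMost y (map val (incSuf _<ᶜ_ p)) ≤ cu + cv
countAtMost-incSuf-Sch {u} {v} {p} inSch with incSuf-suffix _<ᶜ_ p
... | P , p≡ = countAtMost-increasing-suffix-Sch P (subst (InSchProd u v) p≡ inSch)
                 (Linked⇒AllPairs ≺ᶜ-trans (incSuf-increasing p))

incSufI-∷ʳ : ∀ i q t → incSufI i (q ∷ʳ t) ≡ (if val t ≤ᵇ i then incSuf _<ᶜ_ (q ∷ʳ t) else [])
incSufI-∷ʳ i q t rewrite last-∷ʳ q t = refl

Ii-∷ʳ-≤ : ∀ {i} q {t} → val t ≤ i → Ii i (q ∷ʳ t) ≡ I (q ∷ʳ t)
Ii-∷ʳ-≤ {i} q {t} t≤i = cong length (trans (incSufI-∷ʳ i q t) (if-T (≤⇒≤ᵇ t≤i)))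

Ii-∷ʳ-> : ∀ {i} q {t} → ¬ val t ≤ i → Ii i (q ∷ʳ t) ≡ 0
Ii-∷ʳ-> {i} q {t} t≰i = cong length (trans (incSufI-∷ʳ i q t) (if-¬T (t≰i ∘ ≤ᵇ⇒≤ (val t) i)))

incSuf-val≤last : ∀ q t → All (λ a → val a ≤ val t) (incSuf _<ᶜ_ (q ∷ʳ t))
incSuf-val≤last q t with incSuf-∷ʳ _<ᶜ_ q t
... | S , S≡ = subst (All _) (sym S≡) (Linked⇒val≤last S (subst (Linked _≺ᶜ_) S≡ (incSuf-increasing (q ∷ʳ t))))

countAtMost-val-all : ∀ {y S} → All (λ a → val a ≤ y) S → countAtMost y (map val S) ≡ length S
countAtMost-val-all {S = S} S≤y = trans (countAtMost-all (All.map⁺ S≤y)) (length-map val S)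

Ii≤lambda : ∀ {u v} i p → InSchProd u v p → Ii i p ≤ lambda u i + lambda v i
Ii≤lambda {u} {v} i p inSch with reverseView p
... | [] = z≤n
... | q ∶ _ ∶ʳ t with val t ≤? i
...   | no t≰i  = ≤-trans (≤-reflexive (Ii-∷ʳ-> q t≰i)) z≤n
...   | yes t≤i = begin
  Ii i (q ∷ʳ t)                          ≡⟨ Ii-∷ʳ-≤ q t≤i ⟩
  length S                               ≡⟨ countAtMost-val-all S≤i ⟨
  countAtMost i (map val S)              ≤⟨ countAtMost-incSuf-Sch inSch (Lambda-lambda u i) (Lambda-lambda v i) ⟩
  lambda u i + lambda v i                ∎
  where
  open ≤-Reasoning
  S = incSuf _<ᶜ_ (q ∷ʳ t)
  S≤i = All.map (λ a≤t → ≤-trans a≤t t≤i) (incSuf-val≤last q t)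

length≤Ii : ∀ i P {S} → Linked _≺ᶜ_ S → All (λ t → val t ≤ i) S → length S ≤ Ii i (P ++ S)
length≤Ii i P {S} increasing S≤i with reverseView S
... | [] = z≤n
... | S′ ∶ _ ∶ʳ t = begin
  length (S′ ∷ʳ t)                 ≤⟨ length≤incSuf-++ _<ᶜ_ P (Linked.map ≺ᶜ⇒<ᶜ increasing) ⟩
  I (P ++ S′ ∷ʳ t)                 ≡⟨ cong I (++-assoc P S′ [ t ]) ⟨
  I ((P ++ S′) ∷ʳ t)               ≡⟨ Ii-∷ʳ-≤ (P ++ S′) (proj₂ (All.∷ʳ⁻ S≤i)) ⟨
  Ii i ((P ++ S′) ∷ʳ t)            ≡⟨ cong (Ii i) (++-assoc P S′ [ t ]) ⟩
  Ii i (P ++ S′ ∷ʳ t)              ∎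
  where open ≤-Reasoning

-- (x , 1) ≺ᶜ (y , 2) exactly when x ≤ y
merge : List ℕ → List ℕ → List CLetter
merge []       ys       = color 2 ys
merge (x ∷ xs) []       = color 1 (x ∷ xs)
merge (x ∷ xs) (y ∷ ys) =
  if x ≤ᵇ y then (x , 1) ∷ merge xs (y ∷ ys) else (y , 2) ∷ merge (x ∷ xs) ys

merge-Interleave : ∀ xs ys → Interleave (color 1 xs) (color 2 ys) (merge xs ys)
merge-Interleave []       ys       = Interleave-concat [] (color 2 ys)
merge-Interleave (x ∷ xs) []       =
  subst (Interleave (color 1 (x ∷ xs)) []) (++-identityʳ _) (Interleave-concat (color 1 (x ∷ xs)) [])
merge-Interleave (x ∷ xs) (y ∷ ys) = if-elim (Interleave (color 1 (x ∷ xs)) (color 2 (y ∷ ys))) (x ≤ᵇ y)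
  (λ _ → left  (merge-Interleave xs (y ∷ ys)))
  (λ _ → right (merge-Interleave (x ∷ xs) ys))

merge-increasing : ∀ xs ys → AllPairs _<_ xs → AllPairs _<_ ys → AllPairs _≺ᶜ_ (merge xs ys)
merge-increasing []       ys       _  ys↑ = color-increasing 2 ys↑
merge-increasing (x ∷ xs) []       xs↑ _  = color-increasing 1 xs↑
merge-increasing (x ∷ xs) (y ∷ ys) xs↑@(x<xs ∷ xs′↑) ys↑@(y<ys ∷ ys′↑) = if-elim (AllPairs _≺ᶜ_) (x ≤ᵇ y)
  (λ x≤ᵇy → let x≤y = ≤ᵇ⇒≤ x y x≤ᵇy in
    Interleave-All⁺ (merge-Interleave xs (y ∷ ys))
      (All.map⁺ (All.map val< x<xs))
      (All.map⁺ (val≤⇒≺ᶜ x≤y ∷ All.map (λ y<z → val≤⇒≺ᶜ (≤-trans x≤y (<⇒≤ y<z))) y<ys))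
    ∷ merge-increasing xs (y ∷ ys) xs′↑ ys↑)
  (λ x≰ᵇy → let y<x = ≰⇒> (x≰ᵇy ∘ ≤⇒≤ᵇ) in
    Interleave-All⁺ (merge-Interleave (x ∷ xs) ys)
      (All.map⁺ (val< y<x ∷ All.map (λ x<z → val< (<-trans y<x x<z)) x<xs))
      (All.map⁺ (All.map val< y<ys))
    ∷ merge-increasing (x ∷ xs) ys xs↑ ys′↑)

lambda≤Ii : ∀ {u v} i → ¬ Theta u (suc i) → ¬ Theta v (suc i) →
  ∃[ p ] (InSchProd u v p × lambda u i + lambda v i ≤ Ii i p)
lambda≤Ii {u} {v} i ¬θu ¬θv
  with ∃-increasing-suffix i u ¬θu (Lambda-lambda u i) | ∃-increasing-suffix i v ¬θv (Lambda-lambda v i)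
... | as , τ , reduced-a , τ↑ , τ≤i , length-τ | bs , σ , reduced-b , σ↑ , σ≤i , length-σ =
  P ++ S , (as ++ τ , bs ++ σ , reduced-a , reduced-b , shuffle) , (begin
    lambda u i + lambda v i ≡⟨ cong₂ _+_ length-τ length-σ ⟨
    length τ + length σ     ≡⟨ cong₂ _+_ (length-map _ τ) (length-map _ σ) ⟨
    length (color 1 τ) + length (color 2 σ) ≡⟨ Interleave-length (merge-Interleave τ σ) ⟨
    length S                ≤⟨ length≤Ii i P (AllPairs⇒Linked (merge-increasing τ σ τ↑ σ↑))
                                 (Interleave-All⁺ (merge-Interleave τ σ) (All.map⁺ τ≤i) (All.map⁺ σ≤i)) ⟩
    Ii i (P ++ S)           ∎)
  where
  open ≤-Reasoning
  P = color 1 as ++ color 2 bs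
  S = merge τ σ
  shuffle : Interleave (color 1 (as ++ τ)) (color 2 (bs ++ σ)) (P ++ S)
  shuffle = subst₂ (λ xs ys → Interleave xs ys (P ++ S)) (sym (map-++ _ as τ)) (sym (map-++ _ bs σ))
              (Interleave-++ (Interleave-concat (color 1 as) (color 2 bs)) (merge-Interleave τ σ))

MaxI-lambda : ∀ {u v} i → ¬ Theta u (suc i) → ¬ Theta v (suc i) → MaxI u v i (lambda u i + lambda v i)
MaxI-lambda {u} {v} i ¬θu ¬θv with lambda≤Ii i ¬θu ¬θv
... | p , inSch , lambda≤ = (p , inSch , ≤-antisym (Ii≤lambda i p inSch) lambda≤) , λ q inSch′ → Ii≤lambda i q inSch′

-- The index maximizing λ_i(u) + λ_i(v) − i

-≤-⇒+≤+ : ∀ a b c d → + a - + b ℤ.≤ + c - + d → a + d ≤ c + b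
-≤-⇒+≤+ a b c d a-b≤c-d =
  ℤ.drop‿+≤+ (subst₂ ℤ._≤_ (shift (+ a) (+ b) (+ d)) (shift′ (+ c) (+ d) (+ b)) (ℤ.+-monoˡ-≤ (+ b ℤ.+ + d) a-b≤c-d))
  where
  shift : ∀ x y z → (x - y) ℤ.+ (y ℤ.+ z) ≡ x ℤ.+ z
  shift = ℤ-Solver.solve-∀
  shift′ : ∀ x y z → (x - y) ℤ.+ (z ℤ.+ y) ≡ x ℤ.+ z
  shift′ = ℤ-Solver.solve-∀

+≤+⇒-≤- : ∀ a b c d → a + d ≤ c + b → + a - + b ℤ.≤ + c - + d
+≤+⇒-≤- a b c d a+d≤c+b =
  subst₂ ℤ._≤_ (unshift (+ a) (+ d) (+ b)) (unshift′ (+ c) (+ b) (+ d)) (ℤ.+-monoˡ-≤ (ℤ.- (+ b ℤ.+ + d)) (+≤+ a+d≤c+b))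
  where
  unshift : ∀ x y z → (x ℤ.+ y) - (z ℤ.+ y) ≡ x - z
  unshift = ℤ-Solver.solve-∀
  unshift′ : ∀ x y z → (x ℤ.+ y) - (y ℤ.+ z) ≡ x - z
  unshift′ = ℤ-Solver.solve-∀

last-argmax : ∀ (f : ℕ → ℤ) N →
  ∃[ i ] (i ≤ N × (∀ {y} → y ≤ N → f y ℤ.≤ f i) × (∀ {y} → y ≤ N → i < y → f y ℤ.< f i))
last-argmax f zero = 0 , z≤n , (λ { z≤n → ℤ.≤-refl }) , (λ { z≤n () })
last-argmax f (suc N) with last-argmax f N
... | i , i≤N , maximal , strict with f i ℤ.≤? f (suc N)
...   | yes fi≤fN = suc N , ≤-refl , maximal′ , λ y≤1+N 1+N<y → ⊥-elim (<⇒≱ 1+N<y y≤1+N)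
  where
  maximal′ : ∀ {y} → y ≤ suc N → f y ℤ.≤ f (suc N)
  maximal′ y≤1+N with m≤n⇒m<n∨m≡n y≤1+N
  ... | inj₁ (s≤s y≤N) = ℤ.≤-trans (maximal y≤N) fi≤fN
  ... | inj₂ refl      = ℤ.≤-refl
...   | no fi≰fN = i , m≤n⇒m≤1+n i≤N , maximal′ , strict′
  where
  maximal′ : ∀ {y} → y ≤ suc N → f y ℤ.≤ f i
  maximal′ y≤1+N with m≤n⇒m<n∨m≡n y≤1+N
  ... | inj₁ (s≤s y≤N) = maximal y≤N
  ... | inj₂ refl      = ℤ.<⇒≤ (ℤ.≰⇒> fi≰fN)
  strict′ : ∀ {y} → y ≤ suc N → i < y → f y ℤ.< f i
  strict′ y≤1+N i<y with m≤n⇒m<n∨m≡n y≤1+N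
  ... | inj₁ (s≤s y≤N) = strict y≤N i<y
  ... | inj₂ refl      = ℤ.≰⇒> fi≰fN

lambda-stable : ∀ w {N} → bound w ≤ N → ∀ k → lambda w (k + N) ≡ lambda w N
lambda-stable w bound≤N zero    = refl
lambda-stable w {N} bound≤N (suc k) =
  trans (lambda-suc-¬Theta w (k + N) (¬Theta-above-bound {w} (s≤s (≤-trans bound≤N (m≤n+m N k))))) (lambda-stable w bound≤N k)

score : FinPerm → FinPerm → ℕ → ℤ
score u v i = + (lambda u i + lambda v i) - + i

score-Theta : ∀ {u v} i → Theta u (suc i) ⊎ Theta v (suc i) → score u v i ℤ.≤ score u v (suc i)
score-Theta {u} {v} i θ = +≤+⇒-≤- _ i _ (suc i) (begin
  lambda u i + lambda v i + suc i     ≡⟨ +-suc _ i ⟩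
  suc (lambda u i + lambda v i) + i   ≤⟨ +-monoˡ-≤ i (jump θ) ⟩
  lambda u (suc i) + lambda v (suc i) + i ∎)
  where
  open ≤-Reasoning
  jump : Theta u (suc i) ⊎ Theta v (suc i) → suc (lambda u i + lambda v i) ≤ lambda u (suc i) + lambda v (suc i)
  jump (inj₁ θu) = subst (λ l → suc (lambda u i + lambda v i) ≤ l + lambda v (suc i)) (sym (lambda-suc-Theta u i θu))
                     (s≤s (+-monoʳ-≤ (lambda u i) (lambda-≤-suc v i)))
  jump (inj₂ θv) = subst (λ l → suc (lambda u i + lambda v i) ≤ lambda u (suc i) + l) (sym (lambda-suc-Theta v i θv))
                     (≤-trans (≤-reflexive (sym (+-suc (lambda u i) (lambda v i)))) (+-monoˡ-≤ _ (lambda-≤-suc u i)))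

-- take the last maximizer on [0, bound u ⊔ bound v]: a θ at i + 1 would make i + 1 score at least as well
∃-critical-index : ∀ u v →
  ∃[ i ] ((∀ y → score u v y ℤ.≤ score u v i) × ¬ Theta u (suc i) × ¬ Theta v (suc i))
∃-critical-index u v with last-argmax (score u v) (bound u ⊔ bound v)
... | i , i≤N , maximal , strict = i , maximal′ , ¬Theta (inj₁ {B = Theta v (suc i)}) , ¬Theta inj₂
  where
  N = bound u ⊔ bound v
  beyond : ∀ k → score u v (k + N) ℤ.≤ score u v N
  beyond k = +≤+⇒-≤- _ (k + N) _ N (begin
    lambda u (k + N) + lambda v (k + N) + N
      ≡⟨ cong₂ (λ a b → a + b + N) (lambda-stable u (m≤m⊔n _ _) k) (lambda-stable v (m≤n⊔m _ _) k) ⟩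
    lambda u N + lambda v N + N             ≤⟨ +-monoʳ-≤ _ (m≤n+m N k) ⟩
    lambda u N + lambda v N + (k + N)       ∎)
    where open ≤-Reasoning
  maximal′ : ∀ y → score u v y ℤ.≤ score u v i
  maximal′ y with ≤-total y N
  ... | inj₁ y≤N = maximal y≤N
  ... | inj₂ N≤y =
    ℤ.≤-trans (subst (λ z → score u v z ℤ.≤ score u v N) (m∸n+n≡m N≤y) (beyond (y ∸ N))) (maximal ≤-refl)
  ¬Theta : ∀ {P : Set} → (P → Theta u (suc i) ⊎ Theta v (suc i)) → ¬ P
  ¬Theta inj θ with m≤n⇒m<n∨m≡n i≤N
  ... | inj₁ i<N = ℤ.<-irrefl refl (ℤ.<-≤-trans (strict i<N (n<1+n i)) (score-Theta i (inj θ)))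
  ... | inj₂ refl with inj θ
  ...   | inj₁ θu = ¬Theta-above-bound {u} (s≤s (m≤m⊔n _ _)) θu
  ...   | inj₂ θv = ¬Theta-above-bound {v} (s≤s (m≤n⊔m _ _)) θv

-- Maximal bottom rows

mrow-++ : ∀ Z y ys → ∃[ Y ] (mrow (Z ++ y ∷ ys) ≡ Y ++ mrow (y ∷ ys))
mrow-++ []           y ys = [] , refl
mrow-++ (z ∷ [])     y ys = _ ∷ [] , refl
mrow-++ (z ∷ z′ ∷ Z) y ys with mrow-++ (z′ ∷ Z) y ys
... | Y , mrow≡ = m ∷ Y , cong (m ∷_) mrow≡
  where m = mrowStep z z′ (headℤ (mrow (z′ ∷ Z ++ y ∷ ys)))

mrow-break : ∀ {r d} ds → ¬ r ≺ᶜ d → mrow (r ∷ d ∷ ds) ≡ headℤ (mrow (d ∷ ds)) ∷ mrow (d ∷ ds)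
mrow-break ds r⊀d = cong (_∷ _) (if-¬T (r⊀d ∘ <ᶜ⇒≺ᶜ))

last-mrow : ∀ q t → last (mrow (q ∷ʳ t)) ≡ just (+ val t)
last-mrow q t with mrow-++ q t []
... | Y , mrow≡ = trans (cong last mrow≡) (last-∷ʳ Y (+ val t))

incSufIℤ-mrow-∷ʳ : ∀ i q t → incSufIℤ i (mrow (q ∷ʳ t)) ≡ (if val t ≤ᵇ i then incSuf _<ℤ_ (mrow (q ∷ʳ t)) else [])
incSufIℤ-mrow-∷ʳ i q t rewrite last-mrow q t = refl

ascendingFrom : ℤ → ℕ → List ℤ
ascendingFrom a zero    = []
ascendingFrom a (suc n) = a ℤ.+ 1ℤ ∷ ascendingFrom (a ℤ.+ 1ℤ) n

range≡ascendingFrom : ∀ i n → range i n ≡ ascendingFrom (+ i - + n) n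
range≡ascendingFrom i n = trans (map-applyUpTo id _ n) (go n (+ i - + n) _ (λ _ → refl))
  where
  go : ∀ n a (h : ℕ → ℤ) → (∀ t → h t ≡ a ℤ.+ + suc t) → applyUpTo h n ≡ ascendingFrom a n
  go zero    a h h≡ = refl
  go (suc n) a h h≡ = cong₂ _∷_ (h≡ 0) (go n (a ℤ.+ 1ℤ) (h ∘ suc) (λ t → trans (h≡ (suc t)) (shift a (+ suc t))))
    where
    shift : ∀ a x → a ℤ.+ (1ℤ ℤ.+ x) ≡ (a ℤ.+ 1ℤ) ℤ.+ x
    shift = ℤ-Solver.solve-∀

<⇒<ℤ : ∀ {x y} → x ℤ.< y → T (x <ℤ y)
<⇒<ℤ {x} {y} x<y with x ℤ.<? y
... | yes _   = tt
... | no x≮y = x≮y x<y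

<ℤ-irrefl : ∀ x → ¬ T (x <ℤ x)
<ℤ-irrefl x with x ℤ.<? x
... | yes x<x = λ _ → ℤ.<-irrefl refl x<x
... | no  _   = λ ()

ascendingFrom-increasing : ∀ a n → Linked (λ x y → T (x <ℤ y)) (ascendingFrom a n)
ascendingFrom-increasing a zero          = []
ascendingFrom-increasing a (suc zero)    = [-]
ascendingFrom-increasing a (suc (suc n)) =
  <⇒<ℤ {a ℤ.+ 1ℤ} (ℤ.suc[i]≤j⇒i<j (ℤ.≤-reflexive (ℤ.+-comm 1ℤ (a ℤ.+ 1ℤ))))
    ∷ ascendingFrom-increasing (a ℤ.+ 1ℤ) (suc n)

Staircase : ℕ → List CLetter → Set
Staircase i []      = ⊤
Staircase i (t ∷ S) = i ≤ length S + val t × Staircase i S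

Staircase-intro : ∀ i S → (∀ S₁ t S₂ → S ≡ S₁ ++ t ∷ S₂ → i ≤ length S₂ + val t) → Staircase i S
Staircase-intro i []      _    = tt
Staircase-intro i (t ∷ S) step =
  step [] t S refl , Staircase-intro i S (λ S₁ t′ S₂ S≡ → step (t ∷ S₁) t′ S₂ (cong (t ∷_) S≡))

+≤+⇒-≤ : ∀ i l y → i ≤ l + y → + i - + l ℤ.≤ + y
+≤+⇒-≤ i l y i≤l+y = subst (+ i - + l ℤ.≤_) (ℤ.+-identityʳ (+ y))
  (+≤+⇒-≤- i l y 0 (≤-trans (≤-reflexive (+-identityʳ i)) (≤-trans i≤l+y (≤-reflexive (+-comm l y)))))

mrow-ascending : ∀ i S → Linked _≺ᶜ_ S → Staircase i S → All (λ a → val a ≤ i) S →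
  mrow S ≡ ascendingFrom (+ i - + length S) (length S)
mrow-ascending i [] _ _ _ = refl
mrow-ascending i (t ∷ []) _ (i≤t , _) (t≤i ∷ []) =
  cong (_∷ []) (trans (cong +_ (≤-antisym t≤i i≤t)) (sym (cancel (+ i))))
  where
  cancel : ∀ x → (x - 1ℤ) ℤ.+ 1ℤ ≡ x
  cancel = ℤ-Solver.solve-∀
mrow-ascending i (t ∷ t′ ∷ S) (t≺t′ ∷ increasing) (i≤ , staircase) (_ ∷ below)
  rewrite mrow-ascending i (t′ ∷ S) increasing staircase below =
    cong₂ _∷_ head≡ (cong (λ a → ascendingFrom a (suc k)) (sym shift))
  where
  k = length S
  X = + i - + suc k
  shift : (+ i - + suc (suc k)) ℤ.+ 1ℤ ≡ X
  shift = lemma (+ i) (+ suc k)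
    where
    lemma : ∀ x y → (x - (1ℤ ℤ.+ y)) ℤ.+ 1ℤ ≡ x - y
    lemma = ℤ-Solver.solve-∀
  cancel : ∀ x → (x ℤ.+ 1ℤ) - 1ℤ ≡ x
  cancel = ℤ-Solver.solve-∀
  head≡ : mrowStep t t′ (X ℤ.+ 1ℤ) ≡ (+ i - + suc (suc k)) ℤ.+ 1ℤ
  head≡ = begin
    mrowStep t t′ (X ℤ.+ 1ℤ)        ≡⟨ if-T (≺ᶜ⇒<ᶜ t≺t′) ⟩
    + val t ℤ.⊓ ((X ℤ.+ 1ℤ) - 1ℤ)   ≡⟨ cong (+ val t ℤ.⊓_) (cancel X) ⟩
    + val t ℤ.⊓ X                   ≡⟨ ℤ.i≥j⇒i⊓j≡j (+≤+⇒-≤ i (suc k) (val t) i≤) ⟩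
    X                               ≡⟨ shift ⟨
    (+ i - + suc (suc k)) ℤ.+ 1ℤ    ∎
    where open ≡-Reasoning

incSuf-mrow : ∀ i p → Staircase i (incSuf _<ᶜ_ p) → All (λ a → val a ≤ i) (incSuf _<ᶜ_ p) →
  incSuf _<ℤ_ (mrow p) ≡ range i (I p)
incSuf-mrow i p staircase below with incSufView _<ᶜ_ p
... | whole {W} increasing = begin
  incSuf _<ℤ_ (mrow W)                    ≡⟨ cong (incSuf _<ℤ_) (mrow-ascending i W (Linked.map <ᶜ⇒≺ᶜ increasing)
                                               (subst (Staircase i) W≡ staircase) (subst (All _) W≡ below)) ⟩
  incSuf _<ℤ_ (ascendingFrom X (length W)) ≡⟨ incSuf-Linked-id _<ℤ_ (ascendingFrom-increasing X (length W)) ⟩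
  ascendingFrom X (length W)              ≡⟨ range≡ascendingFrom i (length W) ⟨
  range i (length W)                      ≡⟨ cong (range i ∘ length) W≡ ⟨
  range i (I W)                           ∎
  where
  open ≡-Reasoning
  W≡ = incSuf-Linked-id _<ᶜ_ increasing
  X = + i - + length W
... | break Z h w W increasing h⊀w with mrow-++ Z h (w ∷ W)
...   | Y , mrow≡ = begin
  incSuf _<ℤ_ (mrow (Z ++ h ∷ w ∷ W))           ≡⟨ cong (incSuf _<ℤ_) mrow≡ ⟩
  incSuf _<ℤ_ (Y ++ mrow (h ∷ w ∷ W))
                                                ≡⟨ cong (λ r → incSuf _<ℤ_ (Y ++ r)) (mrow-break W (h⊀w ∘ ≺ᶜ⇒<ᶜ)) ⟩
  incSuf _<ℤ_ (Y ++ headℤ (mrow (w ∷ W)) ∷ mrow (w ∷ W))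
                                                ≡⟨ cong (λ r → incSuf _<ℤ_ (Y ++ headℤ r ∷ r)) ascending ⟩
  incSuf _<ℤ_ (Y ++ X₁ ∷ X₁ ∷ ascendingFrom X₁ (length W))
                                                ≡⟨ incSuf-break _<ℤ_ Y X₁ X₁ _ (ascendingFrom-increasing X (length (w ∷ W)))
                                                                (<ℤ-irrefl X₁) ⟩
  ascendingFrom X (length (w ∷ W))              ≡⟨ range≡ascendingFrom i (length (w ∷ W)) ⟨
  range i (length (w ∷ W))                      ≡⟨ cong (range i ∘ length) S≡ ⟨
  range i (I (Z ++ h ∷ w ∷ W))                  ∎
  where
  open ≡-Reasoning
  S≡ = incSuf-break _<ᶜ_ Z h w W increasing h⊀w
  X = + i - + length (w ∷ W)
  X₁ = X ℤ.+ 1ℤ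
  ascending : mrow (w ∷ W) ≡ ascendingFrom X (length (w ∷ W))
  ascending = mrow-ascending i (w ∷ W) (Linked.map <ᶜ⇒≺ᶜ increasing)
                (subst (Staircase i) S≡ staircase) (subst (All _) S≡ below)

-- t and the letters before it in the increasing suffix are ≤ val t, so they are counted by λ_{val t}(u) + λ_{val t}(v)
incSuf-Staircase : ∀ {u v i n p} → (∀ y → score u v y ℤ.≤ + n - + i) → InSchProd u v p → I p ≡ n →
  Staircase i (incSuf _<ᶜ_ p)
incSuf-Staircase {u} {v} {i} {n} {p} maximal inSch I≡n = Staircase-intro i S staircase
  where
  S = incSuf _<ᶜ_ p
  staircase : ∀ S₁ t S₂ → S ≡ S₁ ++ t ∷ S₂ → i ≤ length S₂ + val t
  staircase S₁ t S₂ S≡ = +-cancelˡ-≤ (suc (length S₁)) i (length S₂ + y) (begin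
    suc (length S₁) + i                          ≤⟨ +-monoˡ-≤ i (≤-trans counted bounded) ⟩
    lambda u y + lambda v y + i                  ≤⟨ -≤-⇒+≤+ _ y n i (maximal y) ⟩
    n + y                                        ≡⟨ cong (_+ y) (trans (sym I≡n) (trans (cong length S≡) (length-++ S₁))) ⟩
    length S₁ + suc (length S₂) + y              ≡⟨ rearrange (length S₁) (length S₂) y ⟩
    suc (length S₁) + (length S₂ + y)            ∎)
    where
    open ≤-Reasoning
    y = val t
    rearrange : ∀ a b c → a + suc b + c ≡ suc a + (b + c)
    rearrange = solve-∀
    S₁≺t : All (_≺ᶜ t) S₁
    S₁≺t = AllPairs-before S₁ (subst (AllPairs _≺ᶜ_) S≡ (Linked⇒AllPairs ≺ᶜ-trans (incSuf-increasing p)))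
    bounded : countAtMost y (map val S) ≤ lambda u y + lambda v y
    bounded = countAtMost-incSuf-Sch inSch (Lambda-lambda u y) (Lambda-lambda v y)
    counted : suc (length S₁) ≤ countAtMost y (map val S)
    counted = begin
      suc (length S₁)                                                ≡⟨ +-comm 1 (length S₁) ⟩
      length S₁ + 1                                                  ≡⟨ cong (_+ 1) (countAtMost-val-all (All.map ≺ᶜ⇒val≤ S₁≺t)) ⟨
      countAtMost y (map val S₁) + 1                                 ≤⟨ +-monoʳ-≤ (countAtMost y (map val S₁)) (s≤s z≤n) ⟩
      countAtMost y (map val S₁) + suc (countAtMost y (map val S₂))
        ≡⟨ cong (λ c → countAtMost y (map val S₁) + c) (countAtMost-accept {y} {y} {map val S₂} ≤-refl) ⟨
      countAtMost y (map val S₁) + countAtMost y (y ∷ map val S₂)   ≡⟨ countAtMost-++ y (map val S₁) (y ∷ map val S₂) ⟨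
      countAtMost y (map val S₁ ++ y ∷ map val S₂)                  ≡⟨ cong (countAtMost y) (map-++ val S₁ (t ∷ S₂)) ⟨
      countAtMost y (map val (S₁ ++ t ∷ S₂))                        ≡⟨ cong (countAtMost y ∘ map val) S≡ ⟨
      countAtMost y (map val S)                                      ∎

incSufIℤ-mrow : ∀ {u v i n} → (∀ y → score u v y ℤ.≤ + n - + i) → ∀ p → InSchProd u v p → Ii i p ≡ n →
  incSufIℤ i (mrow p) ≡ [] ⊎ incSufIℤ i (mrow p) ≡ range i (I p)
incSufIℤ-mrow {i = i} maximal p inSch Ii≡n with reverseView p
... | [] = inj₁ refl
... | q ∶ _ ∶ʳ t rewrite incSufIℤ-mrow-∷ʳ i q t with val t ≤? i
...   | no  t≰i = inj₁ (if-¬T (t≰i ∘ ≤ᵇ⇒≤ (val t) i))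
...   | yes t≤i = inj₂ (trans (if-T (≤⇒≤ᵇ t≤i)) (incSuf-mrow i (q ∷ʳ t)
          (incSuf-Staircase maximal inSch (trans (sym (Ii-∷ʳ-≤ q t≤i)) Ii≡n))
          (All.map (λ a≤t → ≤-trans a≤t t≤i) (incSuf-val≤last q t))))

MaxI≤lambda : ∀ {u v i n} → MaxI u v i n → n ≤ lambda u i + lambda v i
MaxI≤lambda {i = i} ((p , inSch , Ii≡n) , _) = subst (_≤ _) Ii≡n (Ii≤lambda i p inSch)

IsMaxOver-MaxI : ∀ {u v i*} → (∀ y → score u v y ℤ.≤ score u v i*) → ¬ Theta u (suc i*) → ¬ Theta v (suc i*) →
  IsMaxOver (λ i x → ∃[ n ] (MaxI u v i n × x ≡ + n - + i)) (score u v i*)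
IsMaxOver-MaxI {i* = i*} maximal ¬θu ¬θv =
  (i* , _ , MaxI-lambda i* ¬θu ¬θv , refl) ,
  λ { i _ (n , maxI , refl) → ℤ.≤-trans (ℤ.+-monoˡ-≤ (ℤ.- + i) (+≤+ (MaxI≤lambda maxI))) (maximal i) }

IsMaxOver-Lambda : ∀ {u v i*} → (∀ y → score u v y ℤ.≤ score u v i*) →
  IsMaxOver (λ i x → ∃[ a ] ∃[ b ] (Lambda u i a × Lambda v i b × x ≡ + (a + b) - + i)) (score u v i*)
IsMaxOver-Lambda {u} {v} {i*} maximal =
  (i* , _ , _ , Lambda-lambda u i* , Lambda-lambda v i* , refl) ,
  λ { i _ (a , b , λu , λv , refl) →
        subst (λ c → + c - + i ℤ.≤ score u v i*)
              (cong₂ _+_ (Lambda-functional (Lambda-lambda u i) λu) (Lambda-functional (Lambda-lambda v i) λv))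
              (maximal i) }

proposition5p16 : (u v : FinPerm) →
    (∃[ m ] (IsMaxOver (λ i x → ∃[ n ] (MaxI u v i n × x ≡ + n - + i)) m
           × IsMaxOver (λ i x → ∃[ a ] ∃[ b ] (Lambda u i a × Lambda v i b × x ≡ + (a + b) - + i)) m))
    × (∀ i n → MaxI u v i n → (∀ i' n' → MaxI u v i' n' → + n' - + i' ℤ.≤ + n - + i) →
         ∀ p → InSchProd u v p → Ii i p ≡ n →
         incSufIℤ i (mrow p) ≡ [] ⊎ incSufIℤ i (mrow p) ≡ range i (I p))
proposition5p16 u v with ∃-critical-index u v
... | i* , maximal , ¬θu , ¬θv =
  (score u v i* , IsMaxOver-MaxI maximal ¬θu ¬θv , IsMaxOver-Lambda {i* = i*} maximal) ,
  λ i n _ maximal-at-i → incSufIℤ-mrow (λ y → ℤ.≤-trans (maximal y) (maximal-at-i i* _ (MaxI-lambda i* ¬θu ¬θv)))
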